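{- Let $G$ be a connected graph with $\chi=\chi(G)\leq 0$ and let $n=|V(G)|$. Then $b(G)\leq b'(G)\leq \Delta(G)+\lfloor c\rfloor$, where \[ c=\frac12-\frac{3\chi}{n}+\sqrt{\frac{25}{4}-\frac{21\chi}{n}+\frac{9\chi^2}{n^2}}. \]
   Context: All graphs are finite, undirected, without loops or multiple edges. For a vertex $v$, $N(v)$ is its set of neighbors and $d(v)=|N(v)|$; $\Delta(G)$ is the maximum degree. A dominating set of $G$ is a set $D\subseteq V(G)$ such that every vertex not in $D$ is adjacent to some vertex of $D$; the domination number is the minimum size of a dominating set. The bondage number $b(G)$ of a nonempty graph $G$ is the smallest number of edges whose removal from $G$ results in a graph with larger domination number. For a nonempty graph $G$ define the integer \[ b'(G)=\min\Big\{\min_{uv\in E(G)}\big(d(u)+d(v)-1-|N(u)\cap N(v)|\big),\ \big\lfloor 4|E(G)|/|V(G)|\big\rfloor-1\Big\}. \] The orientable surface of genus $h$ has Euler characteristic $2-2h$ and the non-orientable surface of genus $k$ has Euler characteristic $2-k$. $\chi(G)$ denotes the largest Euler characteristic of a surface on which $G$ can be embedded (drawn without edge crossings). -}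

module Defs where

open import Data.Bool using (Bool; true; false; _∧_; _∨_; not; if_then_else_; _xor_)
open import Data.Bool.Properties using (∨-comm)
open import Data.Nat using (ℕ; zero; suc; _+_; _*_; _∸_; _≤_; _<_; _⊔_; _⊓_; _<ᵇ_; _≤ᵇ_; ⌊_/2⌋)
open import Data.Nat.DivMod using (_/_)
open import Data.Fin using (Fin; toℕ)
open import Data.List using (List; []; _∷_; map; foldr; allFin; upTo; concatMap)
open import Data.Nat.ListAction using (sum)
open import Data.Bool.ListAction using (all)
open import Data.Product using (Σ; _×_; _,_)
open import Data.Sum using (_⊎_)
open import Data.Integer as ℤ using (ℤ; +_)
open import Relation.Nullary using (¬_)
open import Relation.Binary.PropositionalEquality using (_≡_; refl; cong₂)

record Graph : Set where
  field
    n       : ℕ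
    adj     : Fin n → Fin n → Bool
    adj-sym : ∀ u v → adj u v ≡ adj v u
    adj-irr : ∀ v → adj v v ≡ false
open Graph public

countF : ∀ {k} → (Fin k → Bool) → ℕ
countF {k} p = sum (map (λ i → if p i then 1 else 0) (allFin k))

deg : (G : Graph) → Fin (n G) → ℕ
deg G u = countF (adj G u)

common : (G : Graph) → Fin (n G) → Fin (n G) → ℕ
common G u v = countF (λ w → adj G u w ∧ adj G v w)

edges : Graph → ℕ
edges G = sum (map (λ u → countF (λ v → adj G u v ∧ (toℕ u <ᵇ toℕ v))) (allFin (n G)))

maxDeg : Graph → ℕ
maxDeg G = foldr _⊔_ 0 (map (deg G) (allFin (n G)))

-- floor division (x / 0 := 0, irrelevant here)
divF : ℕ → ℕ → ℕ
divF a zero    = 0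
divF a (suc k) = a / suc k

b′ : Graph → ℕ
b′ G = foldr _⊓_ (divF (4 * edges G) (n G) ∸ 1)
         (concatMap (λ u → concatMap (λ v →
             if adj G u v then (deg G u + deg G v ∸ 1 ∸ common G u v) ∷ [] else [])
           (allFin (n G))) (allFin (n G)))

data Reach (G : Graph) (u : Fin (n G)) : Fin (n G) → Set where
  here : Reach G u u
  step : ∀ {w v} → Reach G u w → adj G w v ≡ true → Reach G u v

Connected : Graph → Set
Connected G = ∀ u v → Reach G u v

Dominating : (G : Graph) → (Fin (n G) → Bool) → Set
Dominating G D = ∀ v → D v ≡ true ⊎ Σ (Fin (n G)) (λ u → D u ≡ true × adj G u v ≡ true)

IsDomNum : Graph → ℕ → Set
IsDomNum G k =
  Σ (Fin (n G) → Bool) (λ D → Dominating G D × countF D ≡ k)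
  × (∀ D → Dominating G D → k ≤ countF D)

removeEdges : (G : Graph) → (Fin (n G) → Fin (n G) → Bool) → Graph
removeEdges G R = record
  { n = n G
  ; adj = λ u v → adj G u v ∧ not (R u v ∨ R v u)
  ; adj-sym = λ u v → cong₂ (λ a b → a ∧ not b) (adj-sym G u v) (∨-comm (R u v) (R v u))
  ; adj-irr = λ v → cong₂ (λ a b → a ∧ b) (adj-irr G v) refl
  }

removedCount : (G : Graph) → (Fin (n G) → Fin (n G) → Bool) → ℕ
removedCount G R = sum (map (λ u → countF (λ v →
  adj G u v ∧ (R u v ∨ R v u) ∧ (toℕ u <ᵇ toℕ v))) (allFin (n G)))

Increases : (G : Graph) → (Fin (n G) → Fin (n G) → Bool) → Set
Increases G R = ∀ γ γ′ → IsDomNum G γ → IsDomNum (removeEdges G R) γ′ → γ < γ′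

IsBondageNumber : Graph → ℕ → Set
IsBondageNumber G b =
  Σ (Fin (n G) → Fin (n G) → Bool) (λ R → removedCount G R ≡ b × Increases G R)
  × (∀ R → Increases G R → b ≤ removedCount G R)

-- Cellular embeddings as (generalized) signed rotation systems

iter : ∀ {A : Set} → (A → A) → ℕ → A → A
iter f zero    x = x
iter f (suc k) x = f (iter f k x)

record Embedding (G : Graph) : Set where
  field
    next prev : Fin (n G) → Fin (n G) → Fin (n G)
    next-nbr  : ∀ v u → adj G v u ≡ true → adj G v (next v u) ≡ true
    prev-nbr  : ∀ v u → adj G v u ≡ true → adj G v (prev v u) ≡ true
    prev-next : ∀ v u → adj G v u ≡ true → prev v (next v u) ≡ u
    next-prev : ∀ v u → adj G v u ≡ true → next v (prev v u) ≡ u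
    cyclic    : ∀ v u w → adj G v u ≡ true → adj G v w ≡ true →
                Σ ℕ (λ k → iter (next v) k u ≡ w)
    twisted   : Fin (n G) → Fin (n G) → Bool
    twisted-sym : ∀ u v → twisted u v ≡ twisted v u
open Embedding public

module _ {G : Graph} (e : Embedding G) where
  State : Set
  State = Fin (n G) × Fin (n G) × Bool

  -- face tracing: traverse dart u→v, switching local orientation on twisted edges
  faceStep : State → State
  faceStep (u , v , ε) =
    let ε′ = ε xor twisted e u v in
    (v , (if ε′ then prev e v u else next e v u) , ε′)

  code : State → ℕ
  code (u , v , ε) = toℕ u * n G * 2 + toℕ v * 2 + (if ε then 1 else 0)

  -- s is the code-minimal state of its faceStep-orbit
  isRep : State → Bool
  isRep s = all (λ k → code s ≤ᵇ code (iter faceStep k s)) (upTo (4 * n G * n G))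

  orbitCount : ℕ
  orbitCount = sum (map (λ u → countF (λ v →
      adj G u v ∧ isRep (u , v , false)) + countF (λ v → adj G u v ∧ isRep (u , v , true)))
    (allFin (n G)))

  -- each face is traced twice (once in each direction)
  faces : ℕ
  faces with edges G
  ... | zero  = 1
  ... | suc _ = ⌊ orbitCount /2⌋

  eulerChar : ℤ
  eulerChar = (+ n G ℤ.- + edges G) ℤ.+ + faces

IsSurfaceEulerChar : Graph → ℤ → Set
IsSurfaceEulerChar G χ =
  Σ (Embedding G) (λ e → eulerChar e ≡ χ) × (∀ (e : Embedding G) → eulerChar e ℤ.≤ χ)

-- ⌊c⌋ with c = 1/2 - 3χ/n + sqrt(25/4 - 21χ/n + 9χ²/n²), via exact integer arithmetic.
-- For N = n > 0:  m ≤ c  ⇔  A ≤ sqrt(D)  where A = 2mN - N + 6χ, D = 25N² - 84χN + 36χ²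
-- ⇔  A < 0  or  A² ≤ D   (D ≥ 0 whenever χ ≤ 0).

LeC : ℕ → ℤ → ℤ → Set
LeC N χ m =
  let N′ = + N
      A  = (+ 2 ℤ.* m ℤ.* N′ ℤ.- N′) ℤ.+ + 6 ℤ.* χ
      D  = (+ 25 ℤ.* N′ ℤ.* N′ ℤ.- + 84 ℤ.* χ ℤ.* N′) ℤ.+ + 36 ℤ.* χ ℤ.* χ
  in A ℤ.< + 0 ⊎ A ℤ.* A ℤ.≤ D

IsFloorC : ℕ → ℤ → ℤ → Set
IsFloorC N χ m = LeC N χ m × ¬ LeC N χ (m ℤ.+ + 1)

{-# OPTIONS --safe #-}
module Submission where

-- b ≤ b′: for an edge uv, removing every edge at v together with the edges from u to vertices
-- outside N[v] raises the domination number (Hartnell–Rall), and so does removing every edge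
-- at u and every edge at w but wx when u, w have a common neighbour x.  A discharging argument
-- finds two such vertices, adjacent or at distance two, whose degrees sum to at most 4|E|/|V|.
--
-- b′ ≤ Δ + ⌊c⌋: suppose b′ ≥ Δ + h with h = ⌊c⌋ + 1; we show h ≤ c.  For h ≥ 3 every edge uv has
-- |N(u) ∩ N(v)| ≤ d(v) − h − 1, so few faces are triangles.  Weighting each state of face
-- tracing by 4 on triangles and 3 otherwise, every face orbit carries weight at least 12 while
-- the states at a vertex v carry at most (6 + min(d(v) − h − 1, 2)) d(v); summing over vertices
-- gives 4 N κ(h) + 24 (h + 3) F ≤ 24 (h + 3) E with κ(h) = h² + 5h + 12.  For h ≤ 2 this already
-- follows from N + F ≤ E (Euler with χ ≤ 0), and together with N − E + F = χ it implies h ≤ c.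

open import Defs
open import Data.Bool using (Bool; true; false; _∧_; _∨_; not; if_then_else_; T; _xor_)
import Data.Bool.Properties as Boolₚ
open Boolₚ using (not-injective; ∧-conicalˡ; ∧-conicalʳ; ∧-assoc; ∧-zeroʳ; ∧-identityʳ; ∨-zeroʳ)
open import Data.Empty using (⊥; ⊥-elim)
open import Data.Fin using (Fin; toℕ; zero; suc; combine)
import Data.Fin.Properties as Finₚ
open Finₚ using (_≟_; toℕ-injective; pigeonhole; any?; toℕ-combine; combine-injectiveˡ; combine-injectiveʳ)
open import Data.List using (List; []; _∷_; map; tabulate; allFin; foldr; concatMap; upTo)
open import Data.List.Membership.Propositional using (_∈_; lose)
open import Data.List.Membership.Propositional.Properties using (∈-allFin; ∈-map⁺; ∈-concatMap⁺; ∈-concatMap⁻; ∈-upTo⁺)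
open import Data.List.Properties using (foldr-preservesᵇ; foldr-forcesᵇ)
open import Data.List.Relation.Unary.Any using (here; there; satisfied)
import Data.List.Relation.Unary.All as All
open import Data.List.Relation.Unary.Unique.Propositional using (Unique)
open import Data.List.Relation.Unary.AllPairs using ([]; _∷_)
open import Data.List.Relation.Unary.All using ([]; _∷_)
import Data.List.Relation.Unary.All.Properties as Allₚ
import Data.Nat.ListAction as List
open import Data.Nat using (ℕ; zero; suc; _+_; _*_; _∸_; _≤_; _<_; z≤n; s≤s; _⊓_; _⊔_; _<ᵇ_; _≤ᵇ_; ⌊_/2⌋; NonZero; >-nonZero; >-nonZero⁻¹)
open import Data.Nat.Properties hiding (_≟_)
open import Data.Nat.DivMod using (_/_; _%_; m*n/n≡m; /-monoˡ-≤; m≡m%n+[m/n]*n; m%n<n)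
open import Algebra.Properties.CommutativeSemigroup +-commutativeSemigroup using () renaming (interchange to +-interchange)
open import Algebra.Properties.Semiring.Sum +-*-semiring
  using (sum; sum-cong-≗; ∑-distrib-+; ∑-comm; *-distribˡ-sum)
open import Data.Product using (Σ; ∃; _×_; _,_; proj₁; proj₂)
open import Data.Product.Properties using (≡-dec)
open import Data.Sum using (_⊎_; inj₁; inj₂)
open import Function using (_∘_)
open import Relation.Nullary using (¬_; Dec; yes; no; does)
open import Relation.Nullary.Decidable using (_×-dec_; _⊎-dec_; ¬?; dec-true; dec-false)
open import Relation.Binary.PropositionalEquality
  using (_≡_; _≢_; refl; sym; trans; cong; cong₂; subst; subst₂; module ≡-Reasoning)
open import Data.Nat.Tactic.RingSolver using (solve-∀)
open import Relation.Binary using (tri<; tri≈; tri>)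

<ᵇ-true : ∀ {m n} → m < n → (m <ᵇ n) ≡ true
<ᵇ-true {m} {n} m<n with m <ᵇ n in eq
... | true  = refl
... | false = ⊥-elim (subst T eq (<⇒<ᵇ m<n))

<ᵇ-false : ∀ {m n} → ¬ m < n → (m <ᵇ n) ≡ false
<ᵇ-false {m} {n} m≮n with m <ᵇ n in eq
... | false = refl
... | true  = ⊥-elim (m≮n (<ᵇ⇒< m n (subst T (sym eq) _)))

≤-by-slack : ∀ {a b} c → a + c ≡ b → a ≤ b
≤-by-slack {a} c refl = m≤m+n a c

from-k+3 : ∀ (P : ℕ → Set) → (∀ k → P (k + 3)) → ∀ h → 3 ≤ h → P h
from-k+3 P P[k+3] h h≥3 = subst P (m∸n+n≡m h≥3) (P[k+3] (h ∸ 3))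

≤∸⇒+≤ : ∀ {a x} y → 0 < a → a ≤ x ∸ y → a + y ≤ x
≤∸⇒+≤ {a} {x} y a>0 a≤x∸y with y ≤? x
... | yes y≤x = ≤-trans (+-monoˡ-≤ y a≤x∸y) (≤-reflexive (m∸n+n≡m y≤x))
... | no  y≰x = ⊥-elim (<⇒≱ a>0 (subst (a ≤_) (m≤n⇒m∸n≡0 (<⇒≤ (≰⇒> y≰x))) a≤x∸y))

2*⌊/2⌋≤ : ∀ x → 2 * ⌊ x /2⌋ ≤ x
2*⌊/2⌋≤ x =
  subst (2 * ⌊ x /2⌋ ≤_) (⌊n/2⌋+⌈n/2⌉≡n x) (+-monoʳ-≤ ⌊ x /2⌋ (≤-trans (≤-reflexive (+-identityʳ _)) (⌊n/2⌋≤⌈n/2⌉ x)))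

*≤⇒≤divF : ∀ N {q X} → 0 < N → N * q ≤ X → q ≤ divF X N
*≤⇒≤divF (suc N) {q} {X} _ Nq≤X =
  subst (_≤ X / suc N) (m*n/n≡m q (suc N)) (/-monoˡ-≤ (suc N) (subst (_≤ X) (*-comm (suc N) q) Nq≤X))

[_] : Bool → ℕ
[ b ] = if b then 1 else 0

sum-map-tabulate : ∀ {k} {A : Set} (f : A → ℕ) (g : Fin k → A) → List.sum (map f (tabulate g)) ≡ sum (f ∘ g)
sum-map-tabulate {zero}  f g = refl
sum-map-tabulate {suc k} f g = cong (f (g zero) +_) (sum-map-tabulate f (g ∘ suc))

sum-mono-≤ : ∀ {k} {f g : Fin k → ℕ} → (∀ i → f i ≤ g i) → sum f ≤ sum g
sum-mono-≤ {zero}  f≤g = z≤n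
sum-mono-≤ {suc k} f≤g = +-mono-≤ (f≤g zero) (sum-mono-≤ (f≤g ∘ suc))

sum-const : ∀ {k} c → sum {k} (λ _ → c) ≡ k * c
sum-const {zero}  c = refl
sum-const {suc k} c = cong (c +_) (sum-const {k} c)

sum-zero : ∀ {k} {f : Fin k → ℕ} → (∀ i → f i ≡ 0) → sum f ≡ 0
sum-zero {k} f≡0 = trans (sum-cong-≗ f≡0) (trans (sum-const {k} 0) (*-zeroʳ k))

point≤sum : ∀ {k} (f : Fin k → ℕ) i → f i ≤ sum f
point≤sum f zero    = m≤m+n (f zero) _
point≤sum f (suc i) = ≤-trans (point≤sum (f ∘ suc) i) (m≤n+m _ (f zero))

sum-single : ∀ {k} {f : Fin k → ℕ} j → (∀ i → i ≢ j → f i ≡ 0) → sum f ≡ f j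
sum-single {suc k} {f} zero    off = trans (cong (f zero +_) (sum-zero (λ i → off (suc i) λ ()))) (+-identityʳ _)
sum-single {suc k} {f} (suc j) off =
  trans (cong (_+ sum (f ∘ suc)) (off zero λ ())) (sum-single j (λ i i≢j → off (suc i) (i≢j ∘ Finₚ.suc-injective)))

sum-pos : ∀ {k} (f : Fin k → ℕ) → 0 < sum f → ∃ λ i → 0 < f i
sum-pos {suc k} f pos with f zero in eq
... | suc _ = zero , subst (0 <_) (sym eq) (s≤s z≤n)
... | zero  = let i , fi>0 = sum-pos (f ∘ suc) pos in suc i , fi>0

fin⇒0< : ∀ {k} → Fin k → 0 < k
fin⇒0< i = >-nonZero⁻¹ _ {{Finₚ.nonZeroIndex i}}

singleSupport⇒sum≤ : ∀ {k} (f : Fin k → ℕ) {m} → (∀ i → f i ≤ m) → (∀ i j → 0 < f i → 0 < f j → i ≡ j) → sum f ≤ m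
singleSupport⇒sum≤ f {m} f≤m unique with sum f in eq
... | zero  = z≤n
... | suc _ = let j , fj>0 = sum-pos f (subst (0 <_) (sym eq) (s≤s z≤n)) in
  subst (_≤ m) (trans (sym (sum-single j (off j fj>0))) eq) (f≤m j)
  where
  off : ∀ j → 0 < f j → ∀ i → i ≢ j → f i ≡ 0
  off j fj>0 i i≢j with f i in fi
  ... | zero  = refl
  ... | suc _ = ⊥-elim (i≢j (unique i j (subst (0 <_) (sym fi) (s≤s z≤n)) fj>0))

_≟ᵇ_ : ∀ {k} → Fin k → Fin k → Bool
i ≟ᵇ j = does (i ≟ j)

≟ᵇ-refl : ∀ {k} (i : Fin k) → (i ≟ᵇ i) ≡ true
≟ᵇ-refl i with i ≟ i
... | yes _   = refl
... | no i≢i = ⊥-elim (i≢i refl)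

≢⇒≟ᵇ-false : ∀ {k} {i j : Fin k} → i ≢ j → (i ≟ᵇ j) ≡ false
≢⇒≟ᵇ-false {i = i} {j} i≢j with i ≟ j
... | yes i≡j = ⊥-elim (i≢j i≡j)
... | no _    = refl

≟ᵇ⇒≡ : ∀ {k} {i j : Fin k} → (i ≟ᵇ j) ≡ true → i ≡ j
≟ᵇ⇒≡ {i = i} {j} eq with i ≟ j
... | yes i≡j = i≡j

sum-[≟ᵇ]* : ∀ {k} (j : Fin k) (f : Fin k → ℕ) → sum (λ i → [ i ≟ᵇ j ] * f i) ≡ f j
sum-[≟ᵇ]* j f = trans (sum-single j off) (trans (cong (λ b → [ b ] * f j) (≟ᵇ-refl j)) (+-identityʳ (f j)))
  where
  off : ∀ i → i ≢ j → [ i ≟ᵇ j ] * f i ≡ 0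
  off i i≢j rewrite ≢⇒≟ᵇ-false i≢j = refl

countF≡sum : ∀ {k} (p : Fin k → Bool) → countF p ≡ sum (λ i → [ p i ])
countF≡sum p = sum-map-tabulate (λ i → [ p i ]) (λ i → i)

countF-cong : ∀ {k} {p q : Fin k → Bool} → (∀ i → p i ≡ q i) → countF p ≡ countF q
countF-cong {p = p} {q} p≡q = begin
  countF p            ≡⟨ countF≡sum p ⟩
  sum (λ i → [ p i ]) ≡⟨ sum-cong-≗ (cong [_] ∘ p≡q) ⟩
  sum (λ i → [ q i ]) ≡⟨ countF≡sum q ⟨
  countF q            ∎
  where open ≡-Reasoning

countF-mono : ∀ {k} {p q : Fin k → Bool} → (∀ i → p i ≡ true → q i ≡ true) → countF p ≤ countF q
countF-mono {p = p} {q} p⇒q =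
  subst₂ _≤_ (sym (countF≡sum p)) (sym (countF≡sum q)) (sum-mono-≤ pointwise)
  where
  pointwise : ∀ i → [ p i ] ≤ [ q i ]
  pointwise i with p i in pi
  ... | false = z≤n
  ... | true rewrite p⇒q i pi = ≤-refl

countF-split : ∀ {k} (p q : Fin k → Bool) → countF p ≡ countF (λ i → p i ∧ q i) + countF (λ i → p i ∧ not (q i))
countF-split p q = begin
  countF p                                                  ≡⟨ countF≡sum p ⟩
  sum (λ i → [ p i ])                                       ≡⟨ sum-cong-≗ (λ i → split (p i) (q i)) ⟩
  sum (λ i → [ p i ∧ q i ] + [ p i ∧ not (q i) ])           ≡⟨ ∑-distrib-+ (λ i → [ p i ∧ q i ]) _ ⟩
  sum (λ i → [ p i ∧ q i ]) + sum (λ i → [ p i ∧ not (q i) ])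
    ≡⟨ cong₂ _+_ (countF≡sum (λ i → p i ∧ q i)) (countF≡sum (λ i → p i ∧ not (q i))) ⟨
  countF (λ i → p i ∧ q i) + countF (λ i → p i ∧ not (q i)) ∎
  where
  open ≡-Reasoning
  split : ∀ a b → [ a ] ≡ [ a ∧ b ] + [ a ∧ not b ]
  split false _     = refl
  split true  false = refl
  split true  true  = refl

countF-single : ∀ {k} (p : Fin k → Bool) j → countF (λ i → p i ∧ (i ≟ᵇ j)) ≡ [ p j ]
countF-single p j = begin
  countF (λ i → p i ∧ (i ≟ᵇ j))        ≡⟨ countF≡sum (λ i → p i ∧ (i ≟ᵇ j)) ⟩
  sum (λ i → [ p i ∧ (i ≟ᵇ j) ])
    ≡⟨ sum-single j (λ i i≢j → trans (cong (λ b → [ p i ∧ b ]) (≢⇒≟ᵇ-false i≢j)) (cong [_] (∧-zeroʳ (p i)))) ⟩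
  [ p j ∧ (j ≟ᵇ j) ]                   ≡⟨ cong (λ b → [ p j ∧ b ]) (≟ᵇ-refl j) ⟩
  [ p j ∧ true ]                       ≡⟨ cong [_] (∧-identityʳ (p j)) ⟩
  [ p j ]                              ∎
  where open ≡-Reasoning

countF-pos : ∀ {k} (p : Fin k → Bool) → 0 < countF p → ∃ λ i → p i ≡ true
countF-pos p pos with sum-pos (λ i → [ p i ]) (subst (0 <_) (countF≡sum p) pos)
... | i , pi>0 with p i in pi
... | true = i , pi

countF-≥1 : ∀ {k} (p : Fin k → Bool) i → p i ≡ true → 1 ≤ countF p
countF-≥1 p i pi = subst (1 ≤_) (sym (countF≡sum p)) (subst (_≤ _) (cong [_] pi) (point≤sum (λ j → [ p j ]) i))

countF-remove : ∀ {k} (p : Fin k → Bool) j → p j ≡ true → countF p ≡ suc (countF (λ i → p i ∧ not (i ≟ᵇ j)))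
countF-remove p j pj =
  trans (countF-split p (_≟ᵇ j)) (cong (_+ countF (λ i → p i ∧ not (i ≟ᵇ j))) (trans (countF-single p j) (cong [_] pj)))

countF-≥2 : ∀ {k} (p : Fin k → Bool) i j → i ≢ j → p i ≡ true → p j ≡ true → 2 ≤ countF p
countF-≥2 p i j i≢j pi pj = subst (2 ≤_) (sym (countF-remove p i pi))
  (s≤s (countF-≥1 _ j (subst (λ b → p j ∧ not b ≡ true) (sym (≢⇒≟ᵇ-false (i≢j ∘ sym))) (trans (∧-identityʳ (p j)) pj))))

countF-∨ : ∀ {k} (p q : Fin k → Bool) → countF (λ i → p i ∨ q i) ≤ countF p + countF q
countF-∨ p q = subst₂ _≤_ (sym (countF≡sum (λ i → p i ∨ q i))) (sym (cong₂ _+_ (countF≡sum p) (countF≡sum q)))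
  (≤-trans (sum-mono-≤ (λ i → [∨]≤ (p i) (q i))) (≤-reflexive (∑-distrib-+ (λ i → [ p i ]) (λ i → [ q i ]))))
  where
  [∨]≤ : ∀ a b → [ a ∨ b ] ≤ [ a ] + [ b ]
  [∨]≤ true  _ = s≤s z≤n
  [∨]≤ false _ = ≤-refl

countF≤2 : ∀ {k} (p : Fin k → Bool) a b → (∀ i → p i ≡ true → i ≡ a ⊎ i ≡ b) → countF p ≤ 2
countF≤2 p a b p⇒ab = begin
  countF p                                   ≤⟨ countF-mono p⇒a∨b ⟩
  countF (λ i → (i ≟ᵇ a) ∨ (i ≟ᵇ b))         ≤⟨ countF-∨ (_≟ᵇ a) (_≟ᵇ b) ⟩
  countF (_≟ᵇ a) + countF (_≟ᵇ b)            ≡⟨ cong₂ _+_ (countF-single (λ _ → true) a) (countF-single (λ _ → true) b) ⟩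
  2                                          ∎
  where
  open ≤-Reasoning
  p⇒a∨b : ∀ i → p i ≡ true → ((i ≟ᵇ a) ∨ (i ≟ᵇ b)) ≡ true
  p⇒a∨b i pi with p⇒ab i pi
  ... | inj₁ refl rewrite ≟ᵇ-refl i = refl
  ... | inj₂ refl rewrite ≟ᵇ-refl i = ∨-zeroʳ (i ≟ᵇ a)

_<ᶠ_ : ∀ {k} → Fin k → Fin k → Bool
i <ᶠ j = toℕ i <ᵇ toℕ j

[∧<ᶠ]+[∧>ᶠ]≡[∧≢] : ∀ {k} b (i j : Fin k) → [ b ∧ (i <ᶠ j) ] + [ b ∧ (j <ᶠ i) ] ≡ [ b ∧ not (i ≟ᵇ j) ]
[∧<ᶠ]+[∧>ᶠ]≡[∧≢] b i j with <-cmp (toℕ i) (toℕ j)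
... | tri< i<j i≢j _ rewrite <ᵇ-true i<j | <ᵇ-false (<⇒≯ i<j) | ≢⇒≟ᵇ-false (i≢j ∘ cong toℕ) | ∧-zeroʳ b = +-identityʳ _
... | tri> _ i≢j j<i rewrite <ᵇ-true j<i | <ᵇ-false (<⇒≯ j<i) | ≢⇒≟ᵇ-false (i≢j ∘ cong toℕ) | ∧-zeroʳ b = refl
... | tri≈ _ i≡j _ rewrite toℕ-injective i≡j | <ᵇ-false (n≮n (toℕ j)) | ≟ᵇ-refl j | ∧-zeroʳ b = refl

sum-countF : ∀ {k l} (p : Fin k → Fin l → Bool) → List.sum (map (λ u → countF (p u)) (allFin k)) ≡ sum (λ u → sum (λ v → [ p u v ]))
sum-countF p = trans (sum-map-tabulate (λ u → countF (p u)) (λ u → u)) (sum-cong-≗ (λ u → countF≡sum (p u)))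

adj-flip : ∀ G {u v} → adj G u v ≡ true → adj G v u ≡ true
adj-flip G {u} {v} uv = trans (adj-sym G v u) uv

adj⇒≢ : ∀ G {u v} → adj G u v ≡ true → u ≢ v
adj⇒≢ G {u} uu refl with trans (sym (adj-irr G u)) uu
... | ()

orientedEdge : (G : Graph) → Fin (n G) → Fin (n G) → ℕ
orientedEdge G u v = [ adj G u v ∧ (u <ᶠ v) ]

edges≡sum : ∀ G → edges G ≡ sum (λ u → sum (λ v → orientedEdge G u v))
edges≡sum G = sum-countF (λ u v → adj G u v ∧ (u <ᶠ v))

[adj]≡oriented : ∀ G u v → [ adj G u v ] ≡ orientedEdge G u v + orientedEdge G v u
[adj]≡oriented G u v rewrite adj-sym G v u | [∧<ᶠ]+[∧>ᶠ]≡[∧≢] (adj G u v) u v with adj G u v in uv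
... | false = refl
... | true rewrite ≢⇒≟ᵇ-false (adj⇒≢ G uv) = refl

handshake : ∀ G → sum (deg G) ≡ 2 * edges G
handshake G = begin
  sum (deg G)                                                       ≡⟨ sum-cong-≗ degree-split ⟩
  sum (λ u → sum (λ v → O u v) + sum (λ v → O v u))                 ≡⟨ ∑-distrib-+ (λ u → sum (λ v → O u v)) _ ⟩
  sum (λ u → sum (λ v → O u v)) + sum (λ u → sum (λ v → O v u))     ≡⟨ cong (sum (λ u → sum (λ v → O u v)) +_) (∑-comm (λ u v → O v u)) ⟩
  sum (λ u → sum (λ v → O u v)) + sum (λ u → sum (λ v → O u v))
    ≡⟨ cong₂ _+_ (edges≡sum G) (trans (cong (_+ 0) (edges≡sum G)) (+-identityʳ _)) ⟨
  2 * edges G                                                       ∎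
  where
  open ≡-Reasoning
  O = orientedEdge G
  degree-split : ∀ u → deg G u ≡ sum (λ v → O u v) + sum (λ v → O v u)
  degree-split u = trans (countF≡sum (adj G u)) (trans (sum-cong-≗ ([adj]≡oriented G u)) (∑-distrib-+ (O u) (λ v → O v u)))

deg≤maxDeg : ∀ G u → deg G u ≤ maxDeg G
deg≤maxDeg G u = ≤-⊔-foldr (∈-map⁺ (deg G) (∈-allFin u))
  where
  ≤-⊔-foldr : ∀ {x xs} → x ∈ xs → x ≤ foldr _⊔_ 0 xs
  ≤-⊔-foldr {xs = y ∷ _}  (here refl) = m≤m⊔n y _
  ≤-⊔-foldr {xs = y ∷ ys} (there x∈)  = ≤-trans (≤-⊔-foldr x∈) (m≤n⊔m y _)

edgeBound : (G : Graph) → Fin (n G) → Fin (n G) → ℕ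
edgeBound G u v = deg G u + deg G v ∸ 1 ∸ common G u v

averageBound : Graph → ℕ
averageBound G = divF (4 * edges G) (n G) ∸ 1

edgeBoundAt : (G : Graph) → Fin (n G) → Fin (n G) → List ℕ
edgeBoundAt G u v = if adj G u v then edgeBound G u v ∷ [] else []

edgeBounds : (G : Graph) → List ℕ
edgeBounds G = concatMap (λ u → concatMap (edgeBoundAt G u) (allFin (n G))) (allFin (n G))

∈-edgeBounds : ∀ G {u v} → adj G u v ≡ true → edgeBound G u v ∈ edgeBounds G
∈-edgeBounds G {u} {v} uv = ∈-concatMap⁺ _ (lose (∈-allFin u) (∈-concatMap⁺ _ (lose (∈-allFin v) here-if-adjacent)))
  where
  here-if-adjacent : edgeBound G u v ∈ edgeBoundAt G u v
  here-if-adjacent rewrite uv = here refl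

edgeBounds-∈ : ∀ G {x} → x ∈ edgeBounds G → ∃ λ u → ∃ λ v → adj G u v ≡ true × x ≡ edgeBound G u v
edgeBounds-∈ G x∈ with satisfied (∈-concatMap⁻ (λ u → concatMap (edgeBoundAt G u) (allFin (n G))) {xs = allFin (n G)} x∈)
... | u , x∈u with satisfied (∈-concatMap⁻ (edgeBoundAt G u) {xs = allFin (n G)} x∈u)
... | v , x∈uv with adj G u v in uv
... | true with x∈uv
... | here x≡ = u , v , uv , x≡

b′≤edgeBound : ∀ G {u v} → adj G u v ≡ true → b′ G ≤ edgeBound G u v
b′≤edgeBound G uv = foldr-⊓≤ (∈-edgeBounds G uv)
  where
  foldr-⊓≤ : ∀ {x z xs} → x ∈ xs → foldr _⊓_ z xs ≤ x
  foldr-⊓≤ {xs = y ∷ _}  (here refl) = m⊓n≤m y _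
  foldr-⊓≤ {xs = y ∷ _}  (there x∈)  = ≤-trans (m⊓n≤n y _) (foldr-⊓≤ x∈)

≤b′ : ∀ G {b} → b ≤ averageBound G → (∀ u v → adj G u v ≡ true → b ≤ edgeBound G u v) → b ≤ b′ G
≤b′ G b≤avg b≤edge = foldr-preservesᵇ ⊓-glb b≤avg (All.tabulate b≤member)
  where
  b≤member : ∀ {x} → x ∈ edgeBounds G → _ ≤ x
  b≤member x∈ with edgeBounds-∈ G x∈
  ... | u , v , uv , refl = b≤edge u v uv

edge-from-edges : ∀ G → 1 ≤ edges G → ∃ λ u → ∃ λ v → adj G u v ≡ true
edge-from-edges G E≥1 with sum-pos _ (subst (1 ≤_) (edges≡sum G) E≥1)
... | u , pos with sum-pos _ pos
... | v , uv>0 with adj G u v in uv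
... | true = u , v , uv

reach⇒neighbour : ∀ G {u v} → Reach G u v → u ≢ v → ∃ λ w → adj G v w ≡ true
reach⇒neighbour G here          u≢u = ⊥-elim (u≢u refl)
reach⇒neighbour G (step {w} _ wv) _  = w , adj-flip G wv

connected⇒deg≥1 : ∀ G → Connected G → 1 ≤ edges G → ∀ v → 1 ≤ deg G v
connected⇒deg≥1 G conn E≥1 v with edge-from-edges G E≥1
... | a , b , ab with a ≟ v
... | no a≢v = let w , vw = reach⇒neighbour G (conn a v) a≢v in countF-≥1 (adj G v) w vw
... | yes refl = countF-≥1 (adj G a) b ab

-- Bondage sets

EdgeSet : Graph → Set
EdgeSet G = Fin (n G) → Fin (n G) → Bool

dartsIn : (G : Graph) → EdgeSet G → ℕ
dartsIn G R = sum (λ x → sum (λ y → [ adj G x y ∧ R x y ]))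

removedCount≤dartsIn : ∀ G R → removedCount G R ≤ dartsIn G R
removedCount≤dartsIn G R = begin
  removedCount G R                                       ≡⟨ sum-countF (λ x y → adj G x y ∧ (R x y ∨ R y x) ∧ (x <ᶠ y)) ⟩
  sum (λ x → sum (λ y → [ A x y ]))                      ≤⟨ sum-mono-≤ (λ x → sum-mono-≤ (λ y → either-dart x y)) ⟩
  sum (λ x → sum (λ y → F x y + F′ x y))                 ≡⟨ sum-cong-≗ (λ x → ∑-distrib-+ (F x) (F′ x)) ⟩
  sum (λ x → sum (F x) + sum (F′ x))                     ≡⟨ ∑-distrib-+ (λ x → sum (F x)) (λ x → sum (F′ x)) ⟩
  sum (λ x → sum (F x)) + sum (λ x → sum (F′ x))         ≡⟨ cong (sum (λ x → sum (F x)) +_) (∑-comm F′) ⟩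
  sum (λ x → sum (F x)) + sum (λ y → sum (λ x → F′ x y)) ≡⟨ ∑-distrib-+ (λ x → sum (F x)) (λ y → sum (λ x → F′ x y)) ⟨
  sum (λ x → sum (F x) + sum (λ y → F′ y x))             ≡⟨ sum-cong-≗ (λ x → ∑-distrib-+ (F x) (λ y → F′ y x)) ⟨
  sum (λ x → sum (λ y → F x y + F′ y x))                 ≤⟨ sum-mono-≤ (λ x → sum-mono-≤ (λ y → both-orientations x y)) ⟩
  dartsIn G R                                            ∎
  where
  open ≤-Reasoning
  A F F′ : Fin (n G) → Fin (n G) → _
  A x y = adj G x y ∧ (R x y ∨ R y x) ∧ (x <ᶠ y)
  F x y = [ (adj G x y ∧ R x y) ∧ (x <ᶠ y) ]
  F′ x y = [ (adj G y x ∧ R y x) ∧ (x <ᶠ y) ]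
  either-dart : ∀ x y → [ A x y ] ≤ F x y + F′ x y
  either-dart x y rewrite adj-sym G y x with adj G x y | R x y | R y x | x <ᶠ y
  ... | false | _     | _ | _     = z≤n
  ... | true  | true  | _ | true  = s≤s z≤n
  ... | true  | true  | _ | false = z≤n
  ... | true  | false | _ | _     = ≤-refl
  both-orientations : ∀ x y → F x y + F′ y x ≤ [ adj G x y ∧ R x y ]
  both-orientations x y rewrite [∧<ᶠ]+[∧>ᶠ]≡[∧≢] (adj G x y ∧ R x y) x y with adj G x y ∧ R x y
  ... | false = z≤n
  ... | true  = [not]≤1 (x ≟ᵇ y)
    where
    [not]≤1 : ∀ b → [ not b ] ≤ 1
    [not]≤1 true  = z≤n
    [not]≤1 false = ≤-refl

BelowEveryBondageSet : Graph → ℕ → Set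
BelowEveryBondageSet G b = ∀ R → Increases G R → b ≤ removedCount G R

below⇒≤dartsIn : ∀ G {b} → BelowEveryBondageSet G b → ∀ R → Increases G R → b ≤ dartsIn G R
below⇒≤dartsIn G below R incr = ≤-trans (below R incr) (removedCount≤dartsIn G R)

DominatedBy : (G : Graph) → (Fin (n G) → Bool) → Fin (n G) → Set
DominatedBy G D z = D z ≡ true ⊎ Σ (Fin (n G)) (λ x → D x ≡ true × adj G x z ≡ true)

delete : ∀ {k} → Fin k → (Fin k → Bool) → Fin k → Bool
delete a D i = D i ∧ not (i ≟ᵇ a)

delete-∈ : ∀ {k} {a i : Fin k} (D : Fin k → Bool) → D i ≡ true → i ≢ a → delete a D i ≡ true
delete-∈ _ Di i≢a rewrite Di | ≢⇒≟ᵇ-false i≢a = refl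

shrinks⇒Increases : ∀ G R → (∀ D′ → Dominating (removeEdges G R) D′ → ∃ λ D → Dominating G D × countF D < countF D′) →
                    Increases G R
shrinks⇒Increases G R shrink γ γ′ (_ , γ-min) ((D′ , dom′ , |D′|≡γ′) , _) with shrink D′ dom′
... | D , dom , |D|<|D′| = ≤-<-trans (γ-min D dom) (subst (countF D <_) |D′|≡γ′ |D|<|D′|)

removeEdges-adj : ∀ G R {x y} → adj (removeEdges G R) x y ≡ true → adj G x y ≡ true × R x y ≡ false × R y x ≡ false
removeEdges-adj G R {x} {y} xy′ with adj G x y | R x y | R y x | xy′
... | true  | false | false | _  = refl , refl , refl
... | true  | true  | _     | ()
... | true  | false | true  | ()
... | false | _     | _     | ()

starWithFan : (G : Graph) → Fin (n G) → Fin (n G) → (Fin (n G) → Bool) → EdgeSet G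
starWithFan G a c B x y = (x ≟ᵇ a) ∨ ((x ≟ᵇ c) ∧ B y)

module _ (G : Graph) (a c : Fin (n G)) (B : Fin (n G) → Bool) where

  private
    R = starWithFan G a c B

  starWithFan-false⇒≢ : ∀ {x y} → R x y ≡ false → x ≢ a
  starWithFan-false⇒≢ {x} {y} Rxy refl with trans (sym Rxy) (cong (_∨ ((x ≟ᵇ c) ∧ B y)) (≟ᵇ-refl x))
  ... | ()

  starWithFan-false⇒fan : c ≢ a → ∀ y → R c y ≡ false → B y ≡ false
  starWithFan-false⇒fan c≢a y Rcy rewrite ≢⇒≟ᵇ-false c≢a | ≟ᵇ-refl c = Rcy

  centre∈dominating : ∀ {D} → Dominating (removeEdges G R) D → D a ≡ true
  centre∈dominating dom with dom a
  ... | inj₁ Da = Da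
  ... | inj₂ (x , _ , xa′) = ⊥-elim (starWithFan-false⇒≢ (proj₂ (proj₂ (removeEdges-adj G R xa′))) refl)

  dartsIn-starWithFan : dartsIn G R ≤ deg G a + countF (λ y → adj G c y ∧ B y)
  dartsIn-starWithFan = begin
    dartsIn G R                                                 ≤⟨ sum-mono-≤ (λ x → sum-mono-≤ (split x)) ⟩
    sum (λ x → sum (λ y → [ x ≟ᵇ a ] * S y + [ x ≟ᵇ c ] * F y)) ≡⟨ sum-cong-≗ (λ x → ∑-distrib-+ (λ y → [ x ≟ᵇ a ] * S y) _) ⟩
    sum (λ x → sum (λ y → [ x ≟ᵇ a ] * S y) + sum (λ y → [ x ≟ᵇ c ] * F y))
        ≡⟨ sum-cong-≗ (λ x → cong₂ _+_ (*-distribˡ-sum [ x ≟ᵇ a ] S) (*-distribˡ-sum [ x ≟ᵇ c ] F)) ⟨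
    sum (λ x → [ x ≟ᵇ a ] * sum S + [ x ≟ᵇ c ] * sum F)         ≡⟨ ∑-distrib-+ (λ x → [ x ≟ᵇ a ] * sum S) _ ⟩
    sum (λ x → [ x ≟ᵇ a ] * sum S) + sum (λ x → [ x ≟ᵇ c ] * sum F)
        ≡⟨ cong₂ _+_ (sum-[≟ᵇ]* a (λ _ → sum S)) (sum-[≟ᵇ]* c (λ _ → sum F)) ⟩
    sum S + sum F                                               ≡⟨ cong₂ _+_ (countF≡sum (adj G a)) (countF≡sum (λ y → adj G c y ∧ B y)) ⟨
    deg G a + countF (λ y → adj G c y ∧ B y)                    ∎
    where
    open ≤-Reasoning
    S F : Fin (n G) → ℕ
    S y = [ adj G a y ]
    F y = [ adj G c y ∧ B y ]
    split : ∀ x y → [ adj G x y ∧ R x y ] ≤ [ x ≟ᵇ a ] * S y + [ x ≟ᵇ c ] * F y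
    split x y with x ≟ a
    ... | yes refl rewrite ∧-identityʳ (adj G x y) | +-identityʳ (S y) = m≤m+n _ _
    ... | no _ with x ≟ c
    ...   | yes refl = ≤-reflexive (sym (+-identityʳ _))
    ...   | no _ rewrite ∧-zeroʳ (adj G x y) = z≤n

-- v becomes isolated, so it lies in every dominating set D′ of G − R; and D′ − v still
-- dominates G, because in G − R the vertex u is dominated by itself or by a neighbour of v.
edgeBondageSet : (G : Graph) → Fin (n G) → Fin (n G) → EdgeSet G
edgeBondageSet G u v = starWithFan G v u (λ y → not (adj G v y) ∧ not (y ≟ᵇ v))

module _ (G : Graph) {u v : Fin (n G)} (uv : adj G u v ≡ true) where

  private
    B : Fin (n G) → Bool
    B y = not (adj G v y) ∧ not (y ≟ᵇ v)
    R = edgeBondageSet G u v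

  edgeBondageSet-increases : Increases G R
  edgeBondageSet-increases = shrinks⇒Increases G R shrink
    where
    adj-v : ∀ {x} → x ≢ v → B x ≡ false → adj G v x ≡ true
    adj-v {x} x≢v Bx rewrite ≢⇒≟ᵇ-false x≢v with adj G v x | Bx
    ... | true  | _  = refl
    ... | false | ()
    shrink : ∀ D′ → Dominating (removeEdges G R) D′ → ∃ λ D → Dominating G D × countF D < countF D′
    shrink D′ dom′ = delete v D′ , dom , ≤-reflexive (sym (countF-remove D′ v (centre∈dominating G v u B dom′)))
      where
      dom : Dominating G (delete v D′)
      dom z = dominate z (z ≟ v) (dom′ z)
        where
        dominate : ∀ z → Dec (z ≡ v) → DominatedBy (removeEdges G R) D′ z → DominatedBy G (delete v D′) z
        dominate z (no z≢v) (inj₁ D′z) = inj₁ (delete-∈ D′ D′z z≢v)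
        dominate z (no _)   (inj₂ (x , D′x , xz′)) =
          let xz , Rxz , _ = removeEdges-adj G R xz′ in inj₂ (x , delete-∈ D′ D′x (starWithFan-false⇒≢ G v u B Rxz) , xz)
        dominate z (yes refl) _ with dom′ u
        ... | inj₁ D′u = inj₂ (u , delete-∈ D′ D′u (adj⇒≢ G uv) , uv)
        ... | inj₂ (x , D′x , xu′) =
          let _ , Rxu , Rux = removeEdges-adj G R xu′
              x≢v = starWithFan-false⇒≢ G v u B Rxu
          in inj₂ (x , delete-∈ D′ D′x x≢v , adj-flip G (adj-v x≢v (starWithFan-false⇒fan G v u B (adj⇒≢ G uv) x Rux)))

  dartsIn-edgeBondageSet : dartsIn G R ≤ edgeBound G u v
  dartsIn-edgeBondageSet = ≤-trans (dartsIn-starWithFan G v u B) (≤-reflexive (sym edgeBound≡))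
    where
    F = countF (λ y → adj G u y ∧ B y)
    c = common G u v
    deg-u : deg G u ≡ c + suc F
    deg-u = trans (countF-split (adj G u) (adj G v)) (cong (c +_) (trans (countF-remove _ v v∈) (cong suc (countF-cong assoc))))
      where
      v∈ : adj G u v ∧ not (adj G v v) ≡ true
      v∈ rewrite uv | adj-irr G v = refl
      assoc : ∀ y → (adj G u y ∧ not (adj G v y)) ∧ not (y ≟ᵇ v) ≡ adj G u y ∧ B y
      assoc y = ∧-assoc (adj G u y) (not (adj G v y)) (not (y ≟ᵇ v))
    edgeBound≡ : edgeBound G u v ≡ deg G v + F
    edgeBound≡ = begin
      deg G u + deg G v ∸ 1 ∸ c     ≡⟨ cong (λ d → d + deg G v ∸ 1 ∸ c) deg-u ⟩
      c + suc F + deg G v ∸ 1 ∸ c   ≡⟨ cong (λ m → m ∸ 1 ∸ c) (regroup c F (deg G v)) ⟩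
      suc (c + (deg G v + F)) ∸ 1 ∸ c ≡⟨ m+n∸m≡n c (deg G v + F) ⟩
      deg G v + F                   ∎
      where
      open ≡-Reasoning
      regroup : ∀ c f d → c + suc f + d ≡ suc (c + (d + f))
      regroup = solve-∀

bondage≤edgeBound : ∀ G {b} → BelowEveryBondageSet G b → ∀ {u v} → adj G u v ≡ true → b ≤ edgeBound G u v
bondage≤edgeBound G below {u} {v} uv =
  ≤-trans (below⇒≤dartsIn G below (edgeBondageSet G u v) (edgeBondageSet-increases G uv)) (dartsIn-edgeBondageSet G uv)

insert : ∀ {k} → Fin k → (Fin k → Bool) → Fin k → Bool
insert a D i = D i ∨ (i ≟ᵇ a)

-- A dominating set of G − R contains the isolated u, and w or its last neighbour x;
-- exchanging u and w for x gives a smaller dominating set of G.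
distanceTwoBondageSet : (G : Graph) → Fin (n G) → Fin (n G) → Fin (n G) → EdgeSet G
distanceTwoBondageSet G u w x = starWithFan G u w (λ z → not (z ≟ᵇ x))

module _ (G : Graph) {u w x : Fin (n G)} (u≢w : u ≢ w) (ux : adj G u x ≡ true) (wx : adj G w x ≡ true) where

  private
    B : Fin (n G) → Bool
    B z = not (z ≟ᵇ x)
    R = distanceTwoBondageSet G u w x

    fan-false⇒x : ∀ z → R w z ≡ false → z ≡ x
    fan-false⇒x z Rwz = ≟ᵇ⇒≡ (not-injective (starWithFan-false⇒fan G u w B (u≢w ∘ sym) z Rwz))

    module Replacement (D′ : Fin (n G) → Bool) (dom′ : Dominating (removeEdges G R) D′) where

      D′-u D′-uw D : Fin (n G) → Bool
      D′-u = delete u D′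
      D′-uw = delete w D′-u
      D = insert x D′-uw

      survives : ∀ {i} → D′ i ≡ true → i ≢ u → i ≢ w → D i ≡ true
      survives {i} D′i i≢u i≢w rewrite delete-∈ D′-u (delete-∈ D′ D′i i≢u) i≢w = refl

      x∈D : D x ≡ true
      x∈D rewrite ≟ᵇ-refl x = ∨-zeroʳ (D′-uw x)

      w-or-x : D′ w ≡ true ⊎ D′ x ≡ true
      w-or-x with dom′ w
      ... | inj₁ D′w = inj₁ D′w
      ... | inj₂ (y , D′y , yw′) with fan-false⇒x y (proj₂ (proj₂ (removeEdges-adj G R yw′)))
      ...   | refl = inj₂ D′y

      D≤D′-u : countF D ≤ countF D′-u
      D≤D′-u with w-or-x
      ... | inj₁ D′w = begin
        countF D                            ≤⟨ countF-∨ D′-uw (_≟ᵇ x) ⟩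
        countF D′-uw + countF (_≟ᵇ x)       ≡⟨ cong (countF D′-uw +_) (countF-single (λ _ → true) x) ⟩
        countF D′-uw + 1                    ≡⟨ +-comm (countF D′-uw) 1 ⟩
        suc (countF D′-uw)                  ≡⟨ countF-remove D′-u w (delete-∈ D′ D′w (u≢w ∘ sym)) ⟨
        countF D′-u                         ∎
        where open ≤-Reasoning
      ... | inj₂ D′x = countF-mono D⊆D′-u
        where
        D⊆D′-u : ∀ i → D i ≡ true → D′-u i ≡ true
        D⊆D′-u i Di with D′-uw i in e
        ... | true  = ∧-conicalˡ _ _ e
        ... | false with ≟ᵇ⇒≡ {i = i} {x} Di
        ...   | refl = delete-∈ D′ D′x (adj⇒≢ G ux ∘ sym)

      D<D′ : countF D < countF D′
      D<D′ = subst (countF D <_) (sym (countF-remove D′ u (centre∈dominating G u w B dom′))) (s≤s D≤D′-u)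

      D-dominates : Dominating G D
      D-dominates z = dominate z (z ≟ x) (z ≟ u) (z ≟ w) (dom′ z)
        where
        dominate : ∀ z → Dec (z ≡ x) → Dec (z ≡ u) → Dec (z ≡ w) → DominatedBy (removeEdges G R) D′ z → DominatedBy G D z
        dominate z (yes refl) _          _          _ = inj₁ x∈D
        dominate z (no _)     (yes refl) _          _ = inj₂ (x , x∈D , adj-flip G ux)
        dominate z (no _)     (no _)     (yes refl) _ = inj₂ (x , x∈D , adj-flip G wx)
        dominate z (no _)     (no z≢u)   (no z≢w)   (inj₁ D′z) = inj₁ (survives D′z z≢u z≢w)
        dominate z (no z≢x)   (no _)     (no _)     (inj₂ (y , D′y , yz′)) =
          let yz , Ryz , _ = removeEdges-adj G R yz′
              y≢w : y ≢ w
              y≢w = λ { refl → z≢x (fan-false⇒x z Ryz) }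
          in inj₂ (y , survives D′y (starWithFan-false⇒≢ G u w B {y} {z} Ryz) y≢w , yz)

  distanceTwoBondageSet-increases : Increases G R
  distanceTwoBondageSet-increases = shrinks⇒Increases G R (λ D′ dom′ → let open Replacement D′ dom′ in D , D-dominates , D<D′)

  dartsIn-distanceTwoBondageSet : dartsIn G R ≤ deg G u + deg G w ∸ 1
  dartsIn-distanceTwoBondageSet = ≤-trans (dartsIn-starWithFan G u w B) (≤-reflexive (sym bound≡))
    where
    F = countF (λ z → adj G w z ∧ B z)
    bound≡ : deg G u + deg G w ∸ 1 ≡ deg G u + F
    bound≡ = trans (cong (λ d → deg G u + d ∸ 1) (countF-remove (adj G w) x wx)) (cong (_∸ 1) (+-suc (deg G u) F))

bondage≤distanceTwo : ∀ G {b} → BelowEveryBondageSet G b → ∀ {u w x} → u ≢ w → adj G u x ≡ true → adj G w x ≡ true →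
                      b ≤ deg G u + deg G w ∸ 1
bondage≤distanceTwo G below {u} {w} {x} u≢w ux wx =
  ≤-trans (below⇒≤dartsIn G below (distanceTwoBondageSet G u w x) (distanceTwoBondageSet-increases G u≢w ux wx))
          (dartsIn-distanceTwoBondageSet G u≢w ux wx)

-- Two close vertices of small total degree

Near : (G : Graph) → Fin (n G) → Fin (n G) → Set
Near G u w = adj G u w ≡ true ⊎ ∃ λ x → adj G u x ≡ true × adj G w x ≡ true

-- Discharging: with t = 2|E| the average of N·d(v), each low vertex v (N·d(v) ≤ t) receives
-- t − N·d(v) + 1 from each neighbour.  By `spread` a vertex has at most one low neighbour and
-- none if it is itself low, so it can pay; summing shows there are no low vertices at all.
module _ (G : Graph) (deg≥1 : ∀ v → 1 ≤ deg G v)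
         (spread : ∀ u w → u ≢ w → Near G u w → 4 * edges G < n G * (deg G u + deg G w)) where

  private
    N = n G
    t = 2 * edges G
    a : Fin N → ℕ
    a v = N * deg G v

    low : Fin N → Bool
    low v = a v ≤ᵇ t

    low⇒≤ : ∀ {v} → low v ≡ true → a v ≤ t
    low⇒≤ {v} lv = ≤ᵇ⇒≤ (a v) t (subst T (sym lv) _)

    high⇒> : ∀ {v} → low v ≡ false → t < a v
    high⇒> {v} hv = ≰⇒> (λ av≤t → subst T hv (≤⇒≤ᵇ av≤t))

    spread′ : ∀ u w → u ≢ w → Near G u w → t + t < a u + a w
    spread′ u w u≢w near = subst₂ _<_ (regroup (edges G)) (*-distribˡ-+ N (deg G u) (deg G w)) (spread u w u≢w near)
      where
      regroup : ∀ e → 4 * e ≡ 2 * e + 2 * e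
      regroup = solve-∀

    low-close⇒⊥ : ∀ {u w} → u ≢ w → Near G u w → low u ≡ true → low w ≡ true → ⊥
    low-close⇒⊥ {u} {w} u≢w near lu lw = <⇒≱ (spread′ u w u≢w near) (+-mono-≤ (low⇒≤ lu) (low⇒≤ lw))

    charge : Fin N → Fin N → ℕ
    charge u v = [ low v ∧ adj G u v ] * suc (t ∸ a v)

    charge>0 : ∀ u v → 0 < charge u v → low v ≡ true × adj G u v ≡ true
    charge>0 u v pos with low v | adj G u v
    ... | true | true = refl , refl

    charged-by-high : ∀ u v → low u ≡ false → charge u v ≤ a u ∸ t
    charged-by-high u v hu with low v in lv | adj G u v in uv
    ... | false | _     = z≤n
    ... | true  | false = z≤n
    ... | true  | true  = ≤-trans (≤-reflexive (+-identityʳ _)) (slack (low⇒≤ lv) (spread′ u v (adj⇒≢ G uv) (inj₁ uv)))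
      where
      slack : ∀ {x y} → y ≤ t → t + t < x + y → suc (t ∸ y) ≤ x ∸ t
      slack {x} {y} y≤t t+t<x+y = m+n≤o⇒m≤o∸n (suc (t ∸ y)) (+-cancelʳ-≤ y _ _ (subst (_≤ x + y) reshuffle t+t<x+y))
        where
        regroup : ∀ s y t → suc ((s + y) + t) ≡ suc s + t + y
        regroup = solve-∀
        reshuffle : suc (t + t) ≡ suc (t ∸ y) + t + y
        reshuffle = trans (cong (λ z → suc (z + t)) (sym (m∸n+n≡m y≤t))) (regroup (t ∸ y) y t)

    one-low-neighbour : ∀ u v w → 0 < charge u v → 0 < charge u w → v ≡ w
    one-low-neighbour u v w cv cw with v ≟ w | charge>0 u v cv | charge>0 u w cw
    ... | yes v≡w | _ | _ = v≡w
    ... | no v≢w | lv , uv | lw , uw = ⊥-elim (low-close⇒⊥ v≢w (inj₂ (u , adj-flip G uv , adj-flip G uw)) lv lw)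

    charges-from : ∀ u → t + sum (charge u) ≤ a u + [ low u ] * (t ∸ a u)
    charges-from u with low u in lu
    ... | true = begin
      t + sum (charge u)       ≡⟨ cong (t +_) (sum-zero uncharged) ⟩
      t + 0                    ≡⟨ +-identityʳ t ⟩
      t                        ≤⟨ m≤n+m∸n t (a u) ⟩
      a u + (t ∸ a u)          ≡⟨ cong (a u +_) (+-identityʳ (t ∸ a u)) ⟨
      a u + (t ∸ a u + 0)      ∎
      where
      open ≤-Reasoning
      uncharged : ∀ v → charge u v ≡ 0
      uncharged v with low v in lv | adj G u v in uv
      ... | false | _     = refl
      ... | true  | false = refl
      ... | true  | true  = ⊥-elim (low-close⇒⊥ (adj⇒≢ G uv) (inj₁ uv) lu lv)
    ... | false = begin
      t + sum (charge u)       ≤⟨ +-monoʳ-≤ t (singleSupport⇒sum≤ (charge u) (λ v → charged-by-high u v lu) (one-low-neighbour u)) ⟩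
      t + (a u ∸ t)            ≡⟨ m+[n∸m]≡n (<⇒≤ (high⇒> lu)) ⟩
      a u                      ≡⟨ +-identityʳ (a u) ⟨
      a u + 0                  ∎
      where open ≤-Reasoning

    charges-to : ∀ v → [ low v ] * suc (t ∸ a v) ≤ sum (λ u → charge u v)
    charges-to v with low v in lv
    ... | false = z≤n
    ... | true with countF-pos (adj G v) (deg≥1 v)
    ...   | u , vu = subst (λ b → [ b ] * suc (t ∸ a v) ≤ sum (λ u → [ adj G u v ] * suc (t ∸ a v))) (adj-flip G vu)
                           (point≤sum (λ u → [ adj G u v ] * suc (t ∸ a v)) u)

    sum-a : sum a ≡ N * t
    sum-a = trans (sym (*-distribˡ-sum N (deg G))) (cong (N *_) (handshake G))

    lows≡0 : sum (λ v → [ low v ]) ≡ 0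
    lows≡0 = n≤0⇒n≡0 (+-cancelˡ-≤ (N * t + S) _ _ (begin
      N * t + S + L                                         ≡⟨ +-assoc (N * t) S L ⟩
      N * t + (S + L)                                       ≡⟨ cong (N * t +_) S+L ⟩
      N * t + sum (λ v → [ low v ] * suc (t ∸ a v))         ≤⟨ +-monoʳ-≤ (N * t) (sum-mono-≤ charges-to) ⟩
      N * t + sum (λ v → sum (λ u → charge u v))            ≡⟨ cong₂ _+_ (sum-const {N} t) (∑-comm charge) ⟨
      sum {N} (λ _ → t) + sum (λ u → sum (charge u))        ≡⟨ ∑-distrib-+ (λ _ → t) (λ u → sum (charge u)) ⟨
      sum (λ u → t + sum (charge u))                        ≤⟨ sum-mono-≤ charges-from ⟩
      sum (λ u → a u + [ low u ] * (t ∸ a u))               ≡⟨ ∑-distrib-+ a (λ u → [ low u ] * (t ∸ a u)) ⟩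
      sum a + S                                             ≡⟨ cong (_+ S) sum-a ⟩
      N * t + S                                             ≡⟨ +-identityʳ (N * t + S) ⟨
      N * t + S + 0                                         ∎))
      where
      open ≤-Reasoning
      S L : ℕ
      S = sum (λ v → [ low v ] * (t ∸ a v))
      L = sum (λ v → [ low v ])
      S+L : S + L ≡ sum (λ v → [ low v ] * suc (t ∸ a v))
      S+L = trans (+-comm S L) (trans (sym (∑-distrib-+ (λ v → [ low v ]) (λ v → [ low v ] * (t ∸ a v))))
                                      (sum-cong-≗ (λ v → sym (*-suc [ low v ] (t ∸ a v)))))

    no-low : ∀ v → low v ≡ false
    no-low v with low v in lv
    ... | false = refl
    ... | true  = ⊥-elim (1+n≰n (subst (1 ≤_) lows≡0 (subst (_≤ sum (λ v → [ low v ])) (cong [_] lv) (point≤sum (λ v → [ low v ]) v))))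

  spread⇒⊥ : Fin (n G) → ⊥
  spread⇒⊥ v₀ = <⇒≱ N*t<sum-a (≤-reflexive sum-a)
    where
    N*t<sum-a : N * t < sum a
    N*t<sum-a = begin-strict
      N * t              <⟨ m<m+n (N * t) (fin⇒0< v₀) ⟩
      N * t + N          ≡⟨ trans (+-comm (N * t) N) (sym (*-suc N t)) ⟩
      N * suc t          ≡⟨ sum-const {N} (suc t) ⟨
      sum {N} (λ _ → suc t) ≤⟨ sum-mono-≤ (λ v → high⇒> (no-low v)) ⟩
      sum a              ∎
      where open ≤-Reasoning

near? : ∀ G u w → Dec (Near G u w)
near? G u w = (adj G u w Boolₚ.≟ true) ⊎-dec any? (λ x → (adj G u x Boolₚ.≟ true) ×-dec (adj G w x Boolₚ.≟ true))

close-pair-of-small-degree : ∀ G → (∀ v → 1 ≤ deg G v) → Fin (n G) →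
                         ∃ λ u → ∃ λ w → u ≢ w × Near G u w × n G * (deg G u + deg G w) ≤ 4 * edges G
close-pair-of-small-degree G deg≥1 v₀ with any? (λ u → any? (λ w → ¬? (u ≟ w) ×-dec near? G u w ×-dec (n G * (deg G u + deg G w) ≤? 4 * edges G)))
... | yes (u , w , pair) = u , w , pair
... | no none = ⊥-elim (spread⇒⊥ G deg≥1 (λ u w u≢w near → ≰⇒> (λ small → none (u , w , u≢w , near , small))) v₀)

bondage≤averageBound : ∀ G {b} → BelowEveryBondageSet G b → (∀ v → 1 ≤ deg G v) → Fin (n G) → b ≤ averageBound G
bondage≤averageBound G below deg≥1 v₀ with close-pair-of-small-degree G deg≥1 v₀
... | u , w , u≢w , near , small =
  ≤-trans (bondage≤close near) (∸-monoˡ-≤ 1 (*≤⇒≤divF (n G) (fin⇒0< v₀) small))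
  where
  bondage≤close : Near G u w → _ ≤ deg G u + deg G w ∸ 1
  bondage≤close (inj₁ uw)            = ≤-trans (bondage≤edgeBound G below uw) (m∸n≤m _ (common G u w))
  bondage≤close (inj₂ (x , ux , wx)) = bondage≤distanceTwo G below u≢w ux wx

bondage≤b′ : ∀ G → Connected G → 1 ≤ edges G → ∀ b → IsBondageNumber G b → b ≤ b′ G
bondage≤b′ G conn E≥1 b (_ , below) =
  ≤b′ G (bondage≤averageBound G below (connected⇒deg≥1 G conn E≥1) (proj₁ (edge-from-edges G E≥1)))
        (λ u v → bondage≤edgeBound G below)

St : ℕ → Set
St k = Fin k × Fin k × Bool

atDart : ∀ {k} → (St k → ℕ) → Fin k → Fin k → ℕ
atDart f u v = f (u , v , false) + f (u , v , true)

∑S : ∀ {k} → (St k → ℕ) → ℕ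
∑S f = sum (λ u → sum (atDart f u))

∑S-zero : ∀ {k} → ∑S {k} (λ _ → 0) ≡ 0
∑S-zero {k} = sum-zero {k} {λ u → sum (atDart (λ _ → 0) u)} (λ u → sum-zero {k} {atDart (λ _ → 0) u} (λ v → refl))

∑S-cong : ∀ {k} {f g : St k → ℕ} → (∀ s → f s ≡ g s) → ∑S f ≡ ∑S g
∑S-cong f≡g = sum-cong-≗ (λ u → sum-cong-≗ (λ v → cong₂ _+_ (f≡g (u , v , false)) (f≡g (u , v , true))))

∑S-mono-≤ : ∀ {k} {f g : St k → ℕ} → (∀ s → f s ≤ g s) → ∑S f ≤ ∑S g
∑S-mono-≤ f≤g = sum-mono-≤ (λ u → sum-mono-≤ (λ v → +-mono-≤ (f≤g (u , v , false)) (f≤g (u , v , true))))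

∑S-distrib-+ : ∀ {k} (f g : St k → ℕ) → ∑S (λ s → f s + g s) ≡ ∑S f + ∑S g
∑S-distrib-+ f g =
  trans (sum-cong-≗ (λ u → trans (sum-cong-≗ (λ v → +-interchange (f (u , v , false)) (g (u , v , false)) (f (u , v , true)) (g (u , v , true))))
                                 (∑-distrib-+ (atDart f u) (atDart g u))))
        (∑-distrib-+ (λ u → sum (atDart f u)) (λ u → sum (atDart g u)))

∑S-*ˡ : ∀ {k} c (f : St k → ℕ) → ∑S (λ s → c * f s) ≡ c * ∑S f
∑S-*ˡ c f = sym (trans (*-distribˡ-sum c (λ u → sum (atDart f u)))
                       (sum-cong-≗ (λ u → trans (*-distribˡ-sum c (atDart f u))
                                                (sum-cong-≗ (λ v → *-distribˡ-+ c (f (u , v , false)) (f (u , v , true)))))))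

∑-∑S : ∀ {k l} (F : Fin l → St k → ℕ) → sum (λ i → ∑S (F i)) ≡ ∑S (λ s → sum (λ i → F i s))
∑-∑S F = trans (∑-comm (λ i u → sum (atDart (F i) u)))
               (sum-cong-≗ (λ u → trans (∑-comm (λ i → atDart (F i) u))
                                        (sum-cong-≗ (λ v → ∑-distrib-+ (λ i → F i (u , v , false)) (λ i → F i (u , v , true))))))

∑S-comm : ∀ {k l} (F : St k → St l → ℕ) → ∑S (λ r → ∑S (F r)) ≡ ∑S (λ s → ∑S (λ r → F r s))
∑S-comm F = trans (sum-cong-≗ (λ u → trans (sum-cong-≗ (λ v → sym (∑S-distrib-+ (F (u , v , false)) (F (u , v , true)))))
                                           (∑-∑S (λ v s → atDart (λ r → F r s) u v))))
                  (∑-∑S (λ u s → sum (atDart (λ r → F r s) u)))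

∑S-single : ∀ {k} {f : St k → ℕ} t → (∀ s → s ≢ t → f s ≡ 0) → ∑S f ≡ f t
∑S-single {f = f} (u₀ , v₀ , b₀) off = trans (sum-single u₀ other-u) (trans (sum-single v₀ other-v) (at-b₀ b₀ refl))
  where
  other-u : ∀ u → u ≢ u₀ → sum (atDart f u) ≡ 0
  other-u u u≢u₀ = sum-zero (λ v → cong₂ _+_ (off (u , v , false) (u≢u₀ ∘ cong proj₁)) (off (u , v , true) (u≢u₀ ∘ cong proj₁)))
  other-v : ∀ v → v ≢ v₀ → atDart f u₀ v ≡ 0
  other-v v v≢v₀ =
    cong₂ _+_ (off (u₀ , v , false) (v≢v₀ ∘ cong (proj₁ ∘ proj₂))) (off (u₀ , v , true) (v≢v₀ ∘ cong (proj₁ ∘ proj₂)))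
  at-b₀ : ∀ b → b ≡ b₀ → f (u₀ , v₀ , false) + f (u₀ , v₀ , true) ≡ f (u₀ , v₀ , b)
  at-b₀ false refl = trans (cong (f (u₀ , v₀ , false) +_) (off _ λ ())) (+-identityʳ _)
  at-b₀ true  refl = cong (_+ f (u₀ , v₀ , true)) (off _ λ ())

∑S-pos : ∀ {k} (f : St k → ℕ) → 0 < ∑S f → ∃ λ s → 0 < f s
∑S-pos f pos with sum-pos _ pos
... | u , pos′ with sum-pos _ pos′
... | v , pos″ with f (u , v , false) in eq
... | suc _ = (u , v , false) , subst (0 <_) (sym eq) (s≤s z≤n)
... | zero  = (u , v , true) , pos″

singleSupport⇒∑S≤ : ∀ {k} (f : St k → ℕ) {m} → (∀ s → f s ≤ m) → (∀ s s′ → 0 < f s → 0 < f s′ → s ≡ s′) → ∑S f ≤ m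
singleSupport⇒∑S≤ f {m} f≤m unique with ∑S f in eq
... | zero  = z≤n
... | suc _ = let t , ft>0 = ∑S-pos f (subst (0 <_) (sym eq) (s≤s z≤n)) in
  subst (_≤ m) (trans (sym (∑S-single t (off t ft>0))) eq) (f≤m t)
  where
  off : ∀ t → 0 < f t → ∀ s → s ≢ t → f s ≡ 0
  off t ft>0 s s≢t with f s in fs
  ... | zero  = refl
  ... | suc _ = ⊥-elim (s≢t (unique s t (subst (0 <_) (sym fs) (s≤s z≤n)) ft>0))

_≟S_ : ∀ {k} (s t : St k) → Dec (s ≡ t)
_≟S_ = ≡-dec _≟_ (≡-dec _≟_ Boolₚ._≟_)

occurrences : ∀ {k} → St k → List (St k) → ℕ
occurrences s xs = List.sum (map (λ x → [ does (s ≟S x) ]) xs)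

∑S-occurrences : ∀ {k} xs (g : St k → ℕ) → ∑S (λ s → occurrences s xs * g s) ≡ List.sum (map g xs)
∑S-occurrences {k} []       g = ∑S-zero {k}
∑S-occurrences (x ∷ xs) g = begin
  ∑S (λ s → ([ does (s ≟S x) ] + occurrences s xs) * g s)
    ≡⟨ ∑S-cong (λ s → *-distribʳ-+ (g s) [ does (s ≟S x) ] (occurrences s xs)) ⟩
  ∑S (λ s → [ does (s ≟S x) ] * g s + occurrences s xs * g s)
    ≡⟨ ∑S-distrib-+ (λ s → [ does (s ≟S x) ] * g s) (λ s → occurrences s xs * g s) ⟩
  ∑S (λ s → [ does (s ≟S x) ] * g s) + ∑S (λ s → occurrences s xs * g s)
    ≡⟨ cong₂ _+_ (∑S-single x off) (∑S-occurrences xs g) ⟩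
  [ does (x ≟S x) ] * g x + List.sum (map g xs)
    ≡⟨ cong (λ b → [ b ] * g x + List.sum (map g xs)) (dec-true (x ≟S x) refl) ⟩
  g x + 0 + List.sum (map g xs)
    ≡⟨ cong (_+ List.sum (map g xs)) (+-identityʳ (g x)) ⟩
  g x + List.sum (map g xs)
    ∎
  where
  open ≡-Reasoning
  off : ∀ s → s ≢ x → [ does (s ≟S x) ] * g s ≡ 0
  off s s≢x rewrite dec-false (s ≟S x) s≢x = refl

occurrences≤1 : ∀ {k} (s : St k) {xs} → Unique xs → occurrences s xs ≤ 1
occurrences≤1 s {[]}     []                = z≤n
occurrences≤1 s {x ∷ xs} (x∉xs ∷ unique) with s ≟S x
... | yes refl = ≤-reflexive (cong suc (absent xs x∉xs))
  where
  absent : ∀ ys → All.All (s ≢_) ys → occurrences s ys ≡ 0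
  absent []       []           = refl
  absent (y ∷ ys) (s≢y ∷ rest) rewrite dec-false (s ≟S y) s≢y = absent ys rest
... | no _ = occurrences≤1 s unique

occurrences>0⇒∈ : ∀ {k} (s : St k) xs → 0 < occurrences s xs → s ∈ xs
occurrences>0⇒∈ s (x ∷ xs) pos with s ≟S x
... | yes s≡x = here s≡x
... | no _    = there (occurrences>0⇒∈ s xs pos)

-- Face tracing

iter-+ : ∀ {A : Set} (f : A → A) a b x → iter f (a + b) x ≡ iter f a (iter f b x)
iter-+ f zero    b x = refl
iter-+ f (suc a) b x = cong f (iter-+ f a b x)

iter-multiple : ∀ {A : Set} (f : A → A) {p x} → iter f p x ≡ x → ∀ q → iter f (q * p) x ≡ x
iter-multiple f         per zero    = refl
iter-multiple f {p} {x} per (suc q) = trans (iter-+ f p (q * p) x) (trans (cong (iter f p) (iter-multiple f per q)) per)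

iter-preserves : ∀ {A : Set} {P : A → Set} (f : A → A) → (∀ {x} → P x → P (f x)) → ∀ k {x} → P x → P (iter f k x)
iter-preserves f pres zero    Px = Px
iter-preserves {P = P} f pres (suc k) {x} Px = pres {iter f k x} (iter-preserves {P = P} f pres k Px)

iter-injective : ∀ {A : Set} {P : A → Set} (f : A → A) → (∀ {x} → P x → P (f x)) →
                 (∀ {x y} → P x → P y → f x ≡ f y → x ≡ y) → ∀ k {x y} → P x → P y → iter f k x ≡ iter f k y → x ≡ y
iter-injective f pres inj zero    Px Py eq = eq
iter-injective {P = P} f pres inj (suc k) {x} {y} Px Py eq =
  iter-injective f pres inj k Px Py (inj {iter f k x} {iter f k y} (iter-preserves {P = P} f pres k Px) (iter-preserves {P = P} f pres k Py) eq)

xor-cancelʳ : ∀ a b c → a xor b ≡ c xor b → a ≡ c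
xor-cancelʳ true  b true  _  = refl
xor-cancelʳ false b false _  = refl
xor-cancelʳ true  b false eq = ⊥-elim (Boolₚ.not-¬ refl (sym eq))
xor-cancelʳ false b true  eq = ⊥-elim (Boolₚ.not-¬ refl eq)

bit : Bool → Fin 2
bit false = zero
bit true  = suc zero

module FaceTracing (G : Graph) (e : Embedding G) where

  N = n G
  S = State e

  trace : S → S
  trace = faceStep e

  isDart : S → Bool
  isDart (u , v , _) = adj G u v

  IsDart : S → Set
  IsDart s = isDart s ≡ true

  turn : Bool → Fin N → Fin N → Fin N
  turn ε v u = if ε then prev e v u else next e v u

  turn-adj : ∀ ε v {u} → adj G v u ≡ true → adj G v (turn ε v u) ≡ true
  turn-adj true  v vu = prev-nbr e v _ vu
  turn-adj false v vu = next-nbr e v _ vu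

  turn-injective : ∀ ε v {u u′} → adj G v u ≡ true → adj G v u′ ≡ true → turn ε v u ≡ turn ε v u′ → u ≡ u′
  turn-injective true  v {u} {u′} vu vu′ eq = trans (sym (next-prev e v u vu)) (trans (cong (next e v) eq) (next-prev e v u′ vu′))
  turn-injective false v {u} {u′} vu vu′ eq = trans (sym (prev-next e v u vu)) (trans (cong (prev e v) eq) (prev-next e v u′ vu′))

  trace-dart : ∀ s → IsDart s → IsDart (trace s)
  trace-dart (u , v , ε) uv = turn-adj (ε xor twisted e u v) v (adj-flip G uv)

  trace-injective : ∀ {s s′} → IsDart s → IsDart s′ → trace s ≡ trace s′ → s ≡ s′
  trace-injective {u , v , ε} {u′ , v′ , ε′} uv u′v′ eq with cong proj₁ eq | cong (proj₂ ∘ proj₂) eq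
  ... | refl | ε₁≡ε₁′ with turn-injective (ε xor twisted e u v) v (adj-flip G uv) (adj-flip G u′v′)
                             (trans (cong (proj₁ ∘ proj₂) eq) (cong (λ b → turn b v u′) (sym ε₁≡ε₁′)))
  ... | refl = cong (λ b → u , v , b) (xor-cancelʳ ε (twisted e u v) ε′ ε₁≡ε₁′)

  it : ℕ → S → S
  it k = iter trace k

  it-dart : ∀ k s → IsDart s → IsDart (it k s)
  it-dart k s = iter-preserves {P = IsDart} trace (λ {s} → trace-dart s) k {s}

  it-injective : ∀ k {s s′} → IsDart s → IsDart s′ → it k s ≡ it k s′ → s ≡ s′
  it-injective = iter-injective {P = IsDart} trace (λ {s} → trace-dart s) (λ {s} {s′} → trace-injective {s} {s′})

  encode : S → Fin (N * N * 2)
  encode (u , v , ε) = combine (combine u v) (bit ε)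

  encode-injective : ∀ {s s′} → encode s ≡ encode s′ → s ≡ s′
  encode-injective {u , v , ε} {u′ , v′ , ε′} eq
    with combine-injectiveˡ (combine u v) (bit ε) (combine u′ v′) (bit ε′) eq
       | combine-injectiveʳ (combine u v) (bit ε) (combine u′ v′) (bit ε′) eq
  ... | uv≡u′v′ | bε≡bε′ with combine-injectiveˡ u v u′ v′ uv≡u′v′ | combine-injectiveʳ u v u′ v′ uv≡u′v′
  ... | refl | refl = cong (λ b → u , v , b) (bit-injective ε ε′ bε≡bε′)
    where
    bit-injective : ∀ a b → bit a ≡ bit b → a ≡ b
    bit-injective false false _ = refl
    bit-injective true  true  _ = refl

  code≡toℕ-encode : ∀ s → code e s ≡ toℕ (encode s)
  code≡toℕ-encode (u , v , ε) = begin
    toℕ u * N * 2 + toℕ v * 2 + [ ε ]                      ≡⟨ cong (toℕ u * N * 2 + toℕ v * 2 +_) (toℕ-bit ε) ⟨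
    toℕ u * N * 2 + toℕ v * 2 + toℕ (bit ε)                ≡⟨ cong (_+ toℕ (bit ε)) (regroup (toℕ u) N (toℕ v)) ⟩
    2 * (N * toℕ u + toℕ v) + toℕ (bit ε)                  ≡⟨ cong (λ m → 2 * m + toℕ (bit ε)) (toℕ-combine u v) ⟨
    2 * toℕ (combine u v) + toℕ (bit ε)                    ≡⟨ toℕ-combine (combine u v) (bit ε) ⟨
    toℕ (encode (u , v , ε))                               ∎
    where
    open ≡-Reasoning
    toℕ-bit : ∀ ε → toℕ (bit ε) ≡ [ ε ]
    toℕ-bit false = refl
    toℕ-bit true  = refl
    regroup : ∀ u N v → u * N * 2 + v * 2 ≡ 2 * (N * u + v)
    regroup = solve-∀

  code-injective : ∀ {s s′} → code e s ≡ code e s′ → s ≡ s′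
  code-injective {s} {s′} eq = encode-injective (toℕ-injective (trans (sym (code≡toℕ-encode s)) (trans eq (code≡toℕ-encode s′))))

  period : ∀ {r} → IsDart r → ∃ λ p → 0 < p × p ≤ N * N * 2 × it p r ≡ r
  period {r} dart with pigeonhole (n<1+n (N * N * 2)) (λ i → encode (it (toℕ i) r))
  ... | i , j , i<j , same = toℕ j ∸ toℕ i , m<n⇒0<n∸m i<j , ≤-trans (m∸n≤m (toℕ j) (toℕ i)) (Finₚ.toℕ≤pred[n] j) ,
                             it-injective (toℕ i) (it-dart (toℕ j ∸ toℕ i) r dart) dart returns
    where
    returns : it (toℕ i) (it (toℕ j ∸ toℕ i) r) ≡ it (toℕ i) r
    returns = begin
      it (toℕ i) (it (toℕ j ∸ toℕ i) r) ≡⟨ iter-+ trace (toℕ i) (toℕ j ∸ toℕ i) r ⟨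
      it (toℕ i + (toℕ j ∸ toℕ i)) r    ≡⟨ cong (λ k → it k r) (m+[n∸m]≡n (<⇒≤ i<j)) ⟩
      it (toℕ j) r                      ≡⟨ encode-injective same ⟨
      it (toℕ i) r                      ∎
      where open ≡-Reasoning

  it-mod : ∀ {r p} .{{_ : NonZero p}} → it p r ≡ r → ∀ k → it k r ≡ it (k % p) r
  it-mod {r} {p} per k = begin
    it k r                           ≡⟨ cong (λ m → it m r) (m≡m%n+[m/n]*n k p) ⟩
    it (k % p + (k / p) * p) r       ≡⟨ iter-+ trace (k % p) ((k / p) * p) r ⟩
    it (k % p) (it ((k / p) * p) r)  ≡⟨ cong (it (k % p)) (iter-multiple trace per (k / p)) ⟩
    it (k % p) r                     ∎
    where open ≡-Reasoning

  IsRep : S → Set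
  IsRep s = isRep e s ≡ true

  rep-below : ∀ {s} → IsRep s → ∀ {k} → k < 4 * N * N → code e s ≤ code e (it k s)
  rep-below {s} rep {k} k< = ≤ᵇ⇒≤ (code e s) (code e (it k s)) (subst T (sym (All.lookup checked (∈-upTo⁺ k<))) _)
    where
    checked : All.All (λ k → (code e s ≤ᵇ code e (it k s)) ≡ true) (upTo (4 * N * N))
    checked = Allₚ.map⁻ (foldr-forcesᵇ {P = _≡ true} (λ x y xy → ∧-conicalˡ x y xy , ∧-conicalʳ x y xy) true _ rep)

  rep-minimal : ∀ {s} → IsDart s → IsRep s → ∀ k → code e s ≤ code e (it k s)
  rep-minimal {s} dart rep k with period dart
  ... | p , p>0 , p≤ , per = subst (λ s′ → code e s ≤ code e s′) (sym (it-mod per k)) (rep-below rep (begin-strict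
      k % p          <⟨ m%n<n k p ⟩
      p              ≤⟨ p≤ ⟩
      N * N * 2      ≤⟨ m≤m+n (N * N * 2) (N * N * 2) ⟩
      N * N * 2 + N * N * 2 ≡⟨ 2+2≡4 N ⟩
      4 * N * N      ∎))
    where
    instance _ = >-nonZero p>0
    open ≤-Reasoning
    2+2≡4 : ∀ N → N * N * 2 + N * N * 2 ≡ 4 * N * N
    2+2≡4 = solve-∀

  same-orbit : ∀ {r r′} a b → IsDart r → it a r ≡ it b r′ → ∃ λ j → r ≡ it j r′
  same-orbit {r} {r′} a b dart meet with period dart
  ... | p , p>0 , _ , per = a * p ∸ a + b , (begin
      r                          ≡⟨ iter-multiple trace per a ⟨
      it (a * p) r               ≡⟨ cong (λ m → it m r) (m∸n+n≡m (m≤m*n a p)) ⟨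
      it (a * p ∸ a + a) r       ≡⟨ iter-+ trace (a * p ∸ a) a r ⟩
      it (a * p ∸ a) (it a r)    ≡⟨ cong (it (a * p ∸ a)) meet ⟩
      it (a * p ∸ a) (it b r′)   ≡⟨ iter-+ trace (a * p ∸ a) b r′ ⟨
      it (a * p ∸ a + b) r′      ∎)
    where
    instance _ = >-nonZero p>0
    open ≡-Reasoning

  reps-coincide : ∀ {r r′} a b → IsDart r → IsDart r′ → IsRep r → IsRep r′ → it a r ≡ it b r′ → r ≡ r′
  reps-coincide {r} {r′} a b dart dart′ rep rep′ meet with same-orbit a b dart meet
  ... | j , r≡ with same-orbit j 0 dart′ (sym r≡)
  ...   | j′ , r′≡ = code-injective (≤-antisym (subst (code e r ≤_) (cong (code e) (sym r′≡)) (rep-minimal dart rep j′))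
                                                (subst (code e r′ ≤_) (cong (code e) (sym r≡)) (rep-minimal dart′ rep′ j)))

  isOrbitRep : S → Bool
  isOrbitRep r = isDart r ∧ isRep e r

  orbitCount≡∑S : orbitCount e ≡ ∑S (λ r → [ isOrbitRep r ])
  orbitCount≡∑S = trans (sum-map-tabulate (λ u → countF (λ v → isOrbitRep (u , v , false)) + countF (λ v → isOrbitRep (u , v , true))) (λ u → u))
    (sum-cong-≗ (λ u → trans (cong₂ _+_ (countF≡sum (λ v → isOrbitRep (u , v , false))) (countF≡sum (λ v → isOrbitRep (u , v , true))))
                             (sym (∑-distrib-+ (λ v → [ isOrbitRep (u , v , false) ]) (λ v → [ isOrbitRep (u , v , true) ])))))

  ∑S-darts : ∀ (g : S → ℕ) → ∑S (λ s → [ isDart s ] * g s) ≡ sum (λ v → sum (λ u → [ adj G v u ] * (g (u , v , false) + g (u , v , true))))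
  ∑S-darts g = trans (sum-cong-≗ (λ u → sum-cong-≗ (λ v → trans (sym (*-distribˡ-+ [ adj G u v ] (g (u , v , false)) (g (u , v , true))))
                                                                 (cong (λ b → [ b ] * (g (u , v , false) + g (u , v , true))) (adj-sym G u v)))))
                     (∑-comm (λ u v → [ adj G v u ] * (g (u , v , false) + g (u , v , true))))

  module _ (deg≥3 : ∀ v → 3 ≤ deg G v) where

    next²≢id : ∀ v {u} → adj G v u ≡ true → next e v (next e v u) ≢ u
    next²≢id v {u} vu next²≡id = <⇒≱ (deg≥3 v) (countF≤2 (adj G v) u (next e v u) two-neighbours)
      where
      two-cycle : ∀ k → iter (next e v) k u ≡ u ⊎ iter (next e v) k u ≡ next e v u
      two-cycle zero = inj₁ refl
      two-cycle (suc k) with two-cycle k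
      ... | inj₁ eq = inj₂ (cong (next e v) eq)
      ... | inj₂ eq = inj₁ (trans (cong (next e v) eq) next²≡id)
      two-neighbours : ∀ w → adj G v w ≡ true → w ≡ u ⊎ w ≡ next e v u
      two-neighbours w vw with cyclic e v u w vu vw
      ... | k , reaches-w with two-cycle k
      ...   | inj₁ eq = inj₁ (trans (sym reaches-w) eq)
      ...   | inj₂ eq = inj₂ (trans (sym reaches-w) eq)

    next≢id : ∀ v {u} → adj G v u ≡ true → next e v u ≢ u
    next≢id v vu eq = next²≢id v vu (trans (cong (next e v) eq) eq)

    prev≢id : ∀ v {u} → adj G v u ≡ true → prev e v u ≢ u
    prev≢id v {u} vu eq = next≢id v vu (trans (cong (next e v) (sym eq)) (next-prev e v u vu))

    next≢prev : ∀ v {u} → adj G v u ≡ true → next e v u ≢ prev e v u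
    next≢prev v {u} vu eq = next²≢id v vu (trans (cong (next e v) eq) (next-prev e v u vu))

    turn≢id : ∀ ε v {u} → adj G v u ≡ true → turn ε v u ≢ u
    turn≢id true  = prev≢id
    turn≢id false = next≢id

    trace-no-fixpoint : ∀ s → IsDart s → s ≢ trace s
    trace-no-fixpoint (u , v , ε) uv eq = adj⇒≢ G uv (cong proj₁ eq)

    trace-no-2-cycle : ∀ s → IsDart s → s ≢ trace (trace s)
    trace-no-2-cycle (u , v , ε) uv eq = turn≢id (ε xor twisted e u v) v (adj-flip G uv) (sym (cong proj₁ eq))

    onTriangle : S → Bool
    onTriangle s = does (it 3 s ≟S s)

    weight : S → ℕ
    weight s = if onTriangle s then 4 else 3

    weight≥3 : ∀ s → 3 ≤ weight s
    weight≥3 s with onTriangle s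
    ... | true  = s≤s (s≤s (s≤s z≤n))
    ... | false = ≤-refl

    weight-triangle : ∀ {s} → it 3 s ≡ s → weight s ≡ 4
    weight-triangle {s} tri rewrite dec-true (it 3 s ≟S s) tri = refl

    -- A representative r owns the first states of its orbit: three of weight 4 if the face
    -- is a triangle, otherwise four of weight at least 3.
    segment : S → List S
    segment r = r ∷ trace r ∷ it 2 r ∷ (if onTriangle r then [] else it 3 r ∷ [])

    segment-unique : ∀ {r} → IsDart r → Unique (segment r)
    segment-unique {r} dart with it 3 r ≟S r
    ... | yes _ = (trace-no-fixpoint r dart ∷ trace-no-2-cycle r dart ∷ [])
                ∷ (trace-no-fixpoint (trace r) (it-dart 1 r dart) ∷ []) ∷ [] ∷ []
    ... | no r≢r₃ = (trace-no-fixpoint r dart ∷ trace-no-2-cycle r dart ∷ r≢r₃ ∘ sym ∷ [])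
                  ∷ (trace-no-fixpoint (trace r) (it-dart 1 r dart) ∷ trace-no-2-cycle (trace r) (it-dart 1 r dart) ∷ [])
                  ∷ (trace-no-fixpoint (it 2 r) (it-dart 2 r dart) ∷ []) ∷ [] ∷ []

    segment-∈ : ∀ {r s} → s ∈ segment r → ∃ λ a → s ≡ it a r
    segment-∈ {r} s∈ with it 3 r ≟S r | s∈
    ... | _     | here eq                      = 0 , eq
    ... | _     | there (here eq)              = 1 , eq
    ... | _     | there (there (here eq))      = 2 , eq
    ... | no _  | there (there (there (here eq))) = 3 , eq

    segment-weight : ∀ r → 12 ≤ List.sum (map weight (segment r))
    segment-weight r with it 3 r ≟S r
    ... | yes tri = ≤-reflexive (sym (cong (4 +_) (cong₂ _+_ (weight-triangle (cong trace tri)) (cong (_+ 0) (weight-triangle (cong (it 2) tri))))))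
    ... | no _ = +-monoʳ-≤ 3 (+-mono-≤ (weight≥3 (trace r)) (+-mono-≤ (weight≥3 (it 2 r)) (+-mono-≤ (weight≥3 (it 3 r)) z≤n)))

    ownedBy : S → S → ℕ
    ownedBy r s = if isOrbitRep r then occurrences s (segment r) else 0

    owner-facts : ∀ r s → 0 < ownedBy r s → IsDart r × IsRep r × ∃ λ a → s ≡ it a r
    owner-facts r s pos with isDart r in dart | isRep e r in rep
    ... | true | true = refl , refl , segment-∈ (occurrences>0⇒∈ s (segment r) pos)

    ownedBy≤1 : ∀ r s → ownedBy r s ≤ 1
    ownedBy≤1 r s with isDart r in dart | isRep e r
    ... | false | _     = z≤n
    ... | true  | false = z≤n
    ... | true  | true  = occurrences≤1 s (segment-unique dart)

    owners≤1 : ∀ s → ∑S (λ r → ownedBy r s) ≤ [ isDart s ]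
    owners≤1 s = singleSupport⇒∑S≤ (λ r → ownedBy r s) owned≤ single-owner
      where
      owned≤ : ∀ r → ownedBy r s ≤ [ isDart s ]
      owned≤ r with 1 ≤? ownedBy r s
      ... | no unowned = ≤-trans (≮⇒≥ unowned) z≤n
      ... | yes owned with owner-facts r s owned
      ...   | dart , _ , a , s≡ = subst (λ b → ownedBy r s ≤ [ b ]) (sym (subst IsDart (sym s≡) (it-dart a r dart))) (ownedBy≤1 r s)
      single-owner : ∀ r r′ → 0 < ownedBy r s → 0 < ownedBy r′ s → r ≡ r′
      single-owner r r′ pos pos′ with owner-facts r s pos | owner-facts r′ s pos′
      ... | dart , rep , a , s≡ | dart′ , rep′ , a′ , s≡′ = reps-coincide a a′ dart dart′ rep rep′ (trans (sym s≡) s≡′)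

    owner-weight : ∀ r → 12 * [ isOrbitRep r ] ≤ ∑S (λ s → ownedBy r s * weight s)
    owner-weight r with isOrbitRep r
    ... | false = z≤n
    ... | true  = subst (12 ≤_) (sym (∑S-occurrences (segment r) weight)) (segment-weight r)

    count-orbits : 12 * ∑S (λ r → [ isOrbitRep r ]) ≤ ∑S (λ s → [ isDart s ] * weight s)
    count-orbits = begin
      12 * ∑S (λ r → [ isOrbitRep r ])                     ≡⟨ ∑S-*ˡ 12 (λ r → [ isOrbitRep r ]) ⟨
      ∑S (λ r → 12 * [ isOrbitRep r ])                     ≤⟨ ∑S-mono-≤ owner-weight ⟩
      ∑S (λ r → ∑S (λ s → ownedBy r s * weight s))         ≡⟨ ∑S-comm (λ r s → ownedBy r s * weight s) ⟩
      ∑S (λ s → ∑S (λ r → ownedBy r s * weight s))         ≡⟨ ∑S-cong (λ s → trans (∑S-cong (λ r → *-comm (ownedBy r s) (weight s)))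
                                                                                   (∑S-*ˡ (weight s) (λ r → ownedBy r s))) ⟩
      ∑S (λ s → weight s * ∑S (λ r → ownedBy r s))         ≤⟨ ∑S-mono-≤ (λ s → *-monoʳ-≤ (weight s) (owners≤1 s)) ⟩
      ∑S (λ s → weight s * [ isDart s ])                   ≡⟨ ∑S-cong (λ s → *-comm (weight s) [ isDart s ]) ⟩
      ∑S (λ s → [ isDart s ] * weight s)                   ∎
      where open ≤-Reasoning

    apex : Bool → Fin N → Fin N → Fin N
    apex ε u v = turn (ε xor twisted e u v) v u

    apex-common : ∀ ε {u v} → adj G u v ≡ true → it 3 (u , v , ε) ≡ (u , v , ε) → (adj G u (apex ε u v) ∧ adj G v (apex ε u v)) ≡ true
    apex-common ε {u} {v} uv triangle rewrite adj-flip G (subst (λ x → adj G (apex ε u v) x ≡ true) (cong proj₁ triangle) (it-dart 2 (u , v , ε) uv))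
      = trace-dart (u , v , ε) uv

    apexes-distinct : ∀ {u v} → adj G v u ≡ true → apex false u v ≢ apex true u v
    apexes-distinct {u} {v} vu with twisted e u v
    ... | false = next≢prev v vu
    ... | true  = next≢prev v vu ∘ sym

    common-nbr : Fin N → Fin N → Fin N → Bool
    common-nbr u v w = adj G u w ∧ adj G v w

    dart-weights : ∀ {u v} → adj G v u ≡ true → weight (u , v , false) + weight (u , v , true) ≤ 6 + (common G u v ⊓ 2)
    dart-weights {u} {v} vu with it 3 (u , v , false) ≟S (u , v , false) | it 3 (u , v , true) ≟S (u , v , true)
    ... | no _        | no _       = m≤m+n 6 _
    ... | yes triangle | no _      = +-monoʳ-≤ 6 (⊓-glb (countF-≥1 (common-nbr u v) _ (apex-common false (adj-flip G vu) triangle)) (s≤s z≤n))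
    ... | no _        | yes triangle = +-monoʳ-≤ 6 (⊓-glb (countF-≥1 (common-nbr u v) _ (apex-common true (adj-flip G vu) triangle)) (s≤s z≤n))
    ... | yes triangle | yes triangle′ = +-monoʳ-≤ 6 (⊓-glb (countF-≥2 (common-nbr u v) _ _ (apexes-distinct vu)
                                           (apex-common false (adj-flip G vu) triangle) (apex-common true (adj-flip G vu) triangle′)) ≤-refl)

    vertex-weights : ∀ v j → (∀ u → adj G v u ≡ true → common G u v ≤ j) →
                     sum (λ u → [ adj G v u ] * (weight (u , v , false) + weight (u , v , true))) ≤ (6 + (j ⊓ 2)) * deg G v
    vertex-weights v j common≤j = begin
      sum (λ u → [ adj G v u ] * (weight (u , v , false) + weight (u , v , true))) ≤⟨ sum-mono-≤ at-neighbour ⟩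
      sum (λ u → (6 + (j ⊓ 2)) * [ adj G v u ])                                   ≡⟨ *-distribˡ-sum (6 + (j ⊓ 2)) (λ u → [ adj G v u ]) ⟨
      (6 + (j ⊓ 2)) * sum (λ u → [ adj G v u ])                                   ≡⟨ cong ((6 + (j ⊓ 2)) *_) (countF≡sum (adj G v)) ⟨
      (6 + (j ⊓ 2)) * deg G v                                                     ∎
      where
      open ≤-Reasoning
      at-neighbour : ∀ u → [ adj G v u ] * (weight (u , v , false) + weight (u , v , true)) ≤ (6 + (j ⊓ 2)) * [ adj G v u ]
      at-neighbour u with adj G v u in vu
      ... | false = z≤n
      ... | true  = subst₂ _≤_ (sym (+-identityʳ _)) (sym (*-identityʳ _))
                      (≤-trans (dart-weights vu) (+-monoʳ-≤ 6 (⊓-monoˡ-≤ 2 (common≤j u vu))))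

-- Counting faces when b′ is large

-- With A, D as in LeC at m = h, D − A² = N (24 (h + 3) E − 4 N κ(h) − 24 (h + 3) F)
-- (discriminant-identity), so FaceBound N E F h implies h ≤ c.
κ : ℕ → ℕ
κ h = h * h + 5 * h + 12

FaceBound : (N E F h : ℕ) → Set
FaceBound N E F h = 4 * N * κ h + 24 * (h + 3) * F ≤ 24 * (h + 3) * E

vertex-inequality₀ : ∀ h → 3 ≤ h → 4 * κ h + (h + 3) * (6 * (h + 1)) ≤ 12 * (h + 3) * (h + 1)
vertex-inequality₀ = from-k+3 (λ h → 4 * κ h + (h + 3) * (6 * (h + 1)) ≤ 12 * (h + 3) * (h + 1)) (λ k → ≤-by-slack (2 * k * k + 16 * k) (slack k))
  where
  slack : ∀ k → 4 * ((k + 3) * (k + 3) + 5 * (k + 3) + 12) + (k + 3 + 3) * (6 * (k + 3 + 1)) + (2 * k * k + 16 * k) ≡ 12 * (k + 3 + 3) * (k + 3 + 1)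
  slack = solve-∀

vertex-inequality₁ : ∀ h → 3 ≤ h → 4 * κ h + (h + 3) * (7 * (h + 2)) ≤ 12 * (h + 3) * (h + 2)
vertex-inequality₁ = from-k+3 (λ h → 4 * κ h + (h + 3) * (7 * (h + 2)) ≤ 12 * (h + 3) * (h + 2)) (λ k → ≤-by-slack (k * k + 11 * k + 6) (slack k))
  where
  slack : ∀ k → 4 * ((k + 3) * (k + 3) + 5 * (k + 3) + 12) + (k + 3 + 3) * (7 * (k + 3 + 2)) + (k * k + 11 * k + 6) ≡ 12 * (k + 3 + 3) * (k + 3 + 2)
  slack = solve-∀

vertex-inequality₂ : ∀ h i → 3 ≤ h → 4 * κ h + (h + 3) * (8 * (h + 3 + i)) ≤ 12 * (h + 3) * (h + 3 + i)
vertex-inequality₂ h i = from-k+3 (λ h → 4 * κ h + (h + 3) * (8 * (h + 3 + i)) ≤ 12 * (h + 3) * (h + 3 + i))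
                                (λ k → ≤-by-slack (4 * k + 4 * (k + 6) * i) (slack k i)) h
  where
  slack : ∀ k i → 4 * ((k + 3) * (k + 3) + 5 * (k + 3) + 12) + (k + 3 + 3) * (8 * (k + 3 + 3 + i)) + (4 * k + 4 * (k + 6) * i)
                  ≡ 12 * (k + 3 + 3) * (k + 3 + 3 + i)
  slack = solve-∀

vertex-inequality : ∀ h j → 3 ≤ h → 4 * κ h + (h + 3) * ((6 + (j ⊓ 2)) * (h + 1 + j)) ≤ 12 * (h + 3) * (h + 1 + j)
vertex-inequality h zero h≥3 =
  subst (λ d → 4 * κ h + (h + 3) * (6 * d) ≤ 12 * (h + 3) * d) (sym (+-identityʳ (h + 1))) (vertex-inequality₀ h h≥3)
vertex-inequality h (suc zero) h≥3 =
  subst (λ d → 4 * κ h + (h + 3) * (7 * d) ≤ 12 * (h + 3) * d) (sym (+-assoc h 1 1)) (vertex-inequality₁ h h≥3)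
vertex-inequality h (suc (suc i)) h≥3 =
  ≤-trans (+-monoʳ-≤ (4 * κ h) (*-monoʳ-≤ (h + 3) (*-monoˡ-≤ (h + 1 + suc (suc i)) (+-monoʳ-≤ 6 (m⊓n≤n (suc (suc i)) 2)))))
          (subst (λ d → 4 * κ h + (h + 3) * (8 * d) ≤ 12 * (h + 3) * d) d≡ (vertex-inequality₂ h i h≥3))
  where
  d≡ : h + 3 + i ≡ h + 1 + suc (suc i)
  d≡ = trans (+-assoc h 3 i) (trans (cong (h +_) (sym (+-suc 1 (suc i)))) (sym (+-assoc h 1 (suc (suc i)))))

faces-of-nonempty : ∀ {G} (e : Embedding G) → 1 ≤ edges G → faces e ≡ ⌊ orbitCount e /2⌋
faces-of-nonempty {G} e E≥1 with edges G
... | suc _ = refl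

module _ (G : Graph) (conn : Connected G) (e : Embedding G) (E≥1 : 1 ≤ edges G)
         (h : ℕ) (h≥3 : 3 ≤ h) (large : maxDeg G + h ≤ b′ G) where

  open FaceTracing G e

  private
    E = edges G

  common+h<deg : ∀ {u v} → adj G u v ≡ true → common G u v + h + 1 ≤ deg G v
  common+h<deg {u} {v} uv = +-cancelˡ-≤ (maxDeg G) _ _ (begin
    maxDeg G + (c + h + 1)        ≡⟨ regroup (maxDeg G) h c ⟩
    maxDeg G + h + c + 1          ≤⟨ ≤∸⇒+≤ 1 (≤-trans Δ+h>0 (m≤m+n _ c)) (≤∸⇒+≤ c Δ+h>0 (≤-trans large (b′≤edgeBound G uv))) ⟩
    deg G u + deg G v             ≤⟨ +-monoˡ-≤ (deg G v) (deg≤maxDeg G u) ⟩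
    maxDeg G + deg G v            ∎)
    where
    open ≤-Reasoning
    c = common G u v
    Δ+h>0 : 0 < maxDeg G + h
    Δ+h>0 = ≤-trans (≤-trans (s≤s z≤n) h≥3) (m≤n+m h (maxDeg G))
    regroup : ∀ Δ h c → Δ + (c + h + 1) ≡ Δ + h + c + 1
    regroup = solve-∀

  deg>h : ∀ v → h + 1 ≤ deg G v
  deg>h v with countF-pos (adj G v) (connected⇒deg≥1 G conn E≥1 v)
  ... | u , vu = ≤-trans (+-monoˡ-≤ 1 (m≤n+m h (common G u v))) (common+h<deg (adj-flip G vu))

  deg≥3 : ∀ v → 3 ≤ deg G v
  deg≥3 v = ≤-trans h≥3 (≤-trans (m≤m+n h 1) (deg>h v))

  Γ : Fin N → ℕ
  Γ v = sum (λ u → [ adj G v u ] * (weight deg≥3 (u , v , false) + weight deg≥3 (u , v , true)))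

  vertex-bound : ∀ v → 4 * κ h + (h + 3) * Γ v ≤ 12 * (h + 3) * deg G v
  vertex-bound v = subst (λ d → 4 * κ h + (h + 3) * Γ v ≤ 12 * (h + 3) * d) d≡
    (≤-trans (+-monoʳ-≤ (4 * κ h) (*-monoʳ-≤ (h + 3) (subst (λ d → Γ v ≤ (6 + (j ⊓ 2)) * d) (sym d≡) (vertex-weights deg≥3 v j common≤j))))
             (vertex-inequality h j h≥3))
    where
    j = deg G v ∸ (h + 1)
    d≡ : h + 1 + j ≡ deg G v
    d≡ = m+[n∸m]≡n (deg>h v)
    common≤j : ∀ u → adj G v u ≡ true → common G u v ≤ j
    common≤j u vu = m+n≤o⇒m≤o∸n (common G u v) (≤-trans (≤-reflexive (sym (+-assoc (common G u v) h 1))) (common+h<deg (adj-flip G vu)))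

  faceBound-large : FaceBound N E (faces e) h
  faceBound-large = begin
    4 * N * κ h + 24 * (h + 3) * F                        ≡⟨ regroup N (κ h) (h + 3) F ⟩
    N * (4 * κ h) + (h + 3) * (12 * (2 * F))              ≤⟨ +-monoʳ-≤ (N * (4 * κ h)) (*-monoʳ-≤ (h + 3) faces≤Γ) ⟩
    N * (4 * κ h) + (h + 3) * sum Γ                       ≡⟨ cong₂ _+_ (sum-const {N} (4 * κ h)) (sym (*-distribˡ-sum (h + 3) Γ)) ⟨
    sum {N} (λ _ → 4 * κ h) + sum (λ v → (h + 3) * Γ v)   ≡⟨ ∑-distrib-+ (λ _ → 4 * κ h) (λ v → (h + 3) * Γ v) ⟨
    sum (λ v → 4 * κ h + (h + 3) * Γ v)                   ≤⟨ sum-mono-≤ vertex-bound ⟩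
    sum (λ v → 12 * (h + 3) * deg G v)                    ≡⟨ *-distribˡ-sum (12 * (h + 3)) (deg G) ⟨
    12 * (h + 3) * sum (deg G)                            ≡⟨ cong (12 * (h + 3) *_) (handshake G) ⟩
    12 * (h + 3) * (2 * E)                                ≡⟨ 12*2≡24 (h + 3) E ⟩
    24 * (h + 3) * E                                      ∎
    where
    open ≤-Reasoning
    F = faces e
    regroup : ∀ N k a F → 4 * N * k + 24 * a * F ≡ N * (4 * k) + a * (12 * (2 * F))
    regroup = solve-∀
    12*2≡24 : ∀ a E → 12 * a * (2 * E) ≡ 24 * a * E
    12*2≡24 = solve-∀
    faces≤Γ : 12 * (2 * F) ≤ sum Γ
    faces≤Γ = begin
      12 * (2 * F)
        ≤⟨ *-monoʳ-≤ 12 (subst (λ f → 2 * f ≤ orbitCount e) (sym (faces-of-nonempty e E≥1)) (2*⌊/2⌋≤ (orbitCount e))) ⟩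
      12 * orbitCount e                                     ≡⟨ cong (12 *_) orbitCount≡∑S ⟩
      12 * ∑S (λ r → [ isOrbitRep r ])                      ≤⟨ count-orbits deg≥3 ⟩
      ∑S (λ s → [ isDart s ] * weight deg≥3 s)              ≡⟨ ∑S-darts (weight deg≥3) ⟩
      sum Γ                                                 ∎

-- Imported only here: the prefix +_ would make the sections (x +_) above ambiguous.
open import Data.Integer as ℤ using (ℤ; +_; -[1+_])
import Data.Integer.Properties as ℤP
open import Data.Integer.Tactic.RingSolver using () renaming (solve-∀ to ℤ-solve-∀)

eulerOf : ℕ → ℕ → ℕ → ℤ
eulerOf N E F = (+ N ℤ.- + E) ℤ.+ + F

discriminant-identity : ∀ (n e f h : ℤ) →
  let χ = (n ℤ.- e) ℤ.+ f
      A = (+ 2 ℤ.* h ℤ.* n ℤ.- n) ℤ.+ + 6 ℤ.* χ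
  in (+ 25 ℤ.* n ℤ.* n ℤ.- + 84 ℤ.* χ ℤ.* n) ℤ.+ + 36 ℤ.* χ ℤ.* χ
     ≡ A ℤ.* A ℤ.+ n ℤ.* (+ 24 ℤ.* (h ℤ.+ + 3) ℤ.* e ℤ.- (+ 4 ℤ.* n ℤ.* (h ℤ.* h ℤ.+ + 5 ℤ.* h ℤ.+ + 12) ℤ.+ + 24 ℤ.* (h ℤ.+ + 3) ℤ.* f))
discriminant-identity = ℤ-solve-∀

FaceBound⇒LeC : ∀ N E F h → FaceBound N E F h → LeC N (eulerOf N E F) (+ h)
FaceBound⇒LeC N E F h faceBound = inj₂ (ℤP.≤-trans (ℤP.i≤i+j (A ℤ.* A) (+ (N * R))) (ℤP.≤-reflexive (sym D≡A²+NR)))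
  where
  χ = eulerOf N E F
  A = (+ 2 ℤ.* + h ℤ.* + N ℤ.- + N) ℤ.+ + 6 ℤ.* χ
  D = (+ 25 ℤ.* + N ℤ.* + N ℤ.- + 84 ℤ.* χ ℤ.* + N) ℤ.+ + 36 ℤ.* χ ℤ.* χ
  P = 4 * N * κ h + 24 * (h + 3) * F
  R = 24 * (h + 3) * E ∸ P
  P′ Q′ : ℤ
  P′ = + 4 ℤ.* + N ℤ.* (+ h ℤ.* + h ℤ.+ + 5 ℤ.* + h ℤ.+ + 12) ℤ.+ + 24 ℤ.* (+ h ℤ.+ + 3) ℤ.* + F
  Q′ = + 24 ℤ.* (+ h ℤ.+ + 3) ℤ.* + E
  +24[h+3]* : ∀ x → + (24 * (h + 3) * x) ≡ + 24 ℤ.* (+ h ℤ.+ + 3) ℤ.* + x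
  +24[h+3]* x = trans (ℤP.pos-* (24 * (h + 3)) x) (cong (ℤ._* + x) (trans (ℤP.pos-* 24 (h + 3)) (cong (+ 24 ℤ.*_) (ℤP.pos-+ h 3))))
  +κ : + κ h ≡ + h ℤ.* + h ℤ.+ + 5 ℤ.* + h ℤ.+ + 12
  +κ = trans (ℤP.pos-+ (h * h + 5 * h) 12) (cong (ℤ._+ + 12) (trans (ℤP.pos-+ (h * h) (5 * h)) (cong₂ ℤ._+_ (ℤP.pos-* h h) (ℤP.pos-* 5 h))))
  +P : + P ≡ P′
  +P = trans (ℤP.pos-+ (4 * N * κ h) _) (cong₂ ℤ._+_ (trans (ℤP.pos-* (4 * N) (κ h)) (cong₂ ℤ._*_ (ℤP.pos-* 4 N) +κ)) (+24[h+3]* F))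
  Q′≡P′+R : Q′ ≡ P′ ℤ.+ + R
  Q′≡P′+R = trans (sym (+24[h+3]* E)) (trans (cong +_ (sym (m+[n∸m]≡n faceBound))) (trans (ℤP.pos-+ P R) (cong (ℤ._+ + R) +P)))
  cancel : ∀ a n p r → a ℤ.+ n ℤ.* ((p ℤ.+ r) ℤ.- p) ≡ a ℤ.+ n ℤ.* r
  cancel = ℤ-solve-∀
  D≡A²+NR : D ≡ A ℤ.* A ℤ.+ + (N * R)
  D≡A²+NR = begin
    D                                                ≡⟨ discriminant-identity (+ N) (+ E) (+ F) (+ h) ⟩
    A ℤ.* A ℤ.+ + N ℤ.* (Q′ ℤ.- P′)                  ≡⟨ cong (λ q → A ℤ.* A ℤ.+ + N ℤ.* (q ℤ.- P′)) Q′≡P′+R ⟩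
    A ℤ.* A ℤ.+ + N ℤ.* ((P′ ℤ.+ + R) ℤ.- P′)        ≡⟨ cancel (A ℤ.* A) (+ N) P′ (+ R) ⟩
    A ℤ.* A ℤ.+ + N ℤ.* + R                          ≡⟨ cong (λ z → A ℤ.* A ℤ.+ z) (ℤP.pos-* N R) ⟨
    A ℤ.* A ℤ.+ + (N * R)                            ∎
    where open ≡-Reasoning

LeC-negative : ∀ N E F j → 0 < N → N + F ≤ E → LeC N (eulerOf N E F) -[1+ j ]
LeC-negative N E F j N>0 N+F≤E = subst (λ E → LeC N (eulerOf N E F) -[1+ j ]) (m+[n∸m]≡n N+F≤E) (inj₁ A<0)
  where
  y = E ∸ (N + F)
  X = 2 * suc j * N + N + 6 * y
  identity : ∀ (J n f y : ℤ) →
    (+ 2 ℤ.* (ℤ.- J) ℤ.* n ℤ.- n) ℤ.+ + 6 ℤ.* ((n ℤ.- ((n ℤ.+ f) ℤ.+ y)) ℤ.+ f) ≡ ℤ.- (+ 2 ℤ.* J ℤ.* n ℤ.+ n ℤ.+ + 6 ℤ.* y)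
  identity = ℤ-solve-∀
  +X : + X ≡ + 2 ℤ.* + suc j ℤ.* + N ℤ.+ + N ℤ.+ + 6 ℤ.* + y
  +X = trans (ℤP.pos-+ (2 * suc j * N + N) (6 * y))
             (cong₂ ℤ._+_ (trans (ℤP.pos-+ (2 * suc j * N) N) (cong (ℤ._+ + N) (trans (ℤP.pos-* (2 * suc j) N) (cong (ℤ._* + N) (ℤP.pos-* 2 (suc j))))))
                          (ℤP.pos-* 6 y))
  +E : + (N + F + y) ≡ (+ N ℤ.+ + F) ℤ.+ + y
  +E = trans (ℤP.pos-+ (N + F) y) (cong (ℤ._+ + y) (ℤP.pos-+ N F))
  A<0 : (+ 2 ℤ.* -[1+ j ] ℤ.* + N ℤ.- + N) ℤ.+ + 6 ℤ.* eulerOf N (N + F + y) F ℤ.< + 0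
  A<0 = subst (ℤ._< + 0)
          (sym (trans (cong (λ z → (+ 2 ℤ.* -[1+ j ] ℤ.* + N ℤ.- + N) ℤ.+ + 6 ℤ.* ((+ N ℤ.- z) ℤ.+ + F)) +E)
                      (trans (identity (+ suc j) (+ N) (+ F) (+ y)) (cong ℤ.-_ (sym +X)))))
          (negative (≤-trans N>0 (≤-trans (m≤n+m N (2 * suc j * N)) (m≤m+n _ (6 * y)))))
    where
    negative : ∀ {x} → 0 < x → ℤ.- (+ x) ℤ.< + 0
    negative {suc _} _ = ℤ.-<+

faceBound-small : ∀ N E F h → h ≤ 3 → N + F ≤ E → FaceBound N E F h
faceBound-small N E F h h≤3 N+F≤E = begin
  4 * N * κ h + 24 * (h + 3) * F          ≡⟨ cong (_+ 24 * (h + 3) * F) (swap-factors N (κ h)) ⟩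
  4 * κ h * N + 24 * (h + 3) * F          ≤⟨ +-monoˡ-≤ (24 * (h + 3) * F) (*-monoˡ-≤ N (4κ≤ h h≤3)) ⟩
  24 * (h + 3) * N + 24 * (h + 3) * F     ≡⟨ *-distribˡ-+ (24 * (h + 3)) N F ⟨
  24 * (h + 3) * (N + F)                  ≤⟨ *-monoʳ-≤ (24 * (h + 3)) N+F≤E ⟩
  24 * (h + 3) * E                        ∎
  where
  open ≤-Reasoning
  swap-factors : ∀ N k → 4 * N * k ≡ 4 * k * N
  swap-factors = solve-∀
  4κ≤ : ∀ h → h ≤ 3 → 4 * κ h ≤ 24 * (h + 3)
  4κ≤ 0 _ = m≤m+n 48 24
  4κ≤ 1 _ = m≤m+n 72 24
  4κ≤ 2 _ = m≤m+n 104 16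
  4κ≤ 3 _ = ≤-refl
  4κ≤ (suc (suc (suc (suc _)))) (s≤s (s≤s (s≤s ())))


euler≤0⇒N+F≤E : ∀ N E F → eulerOf N E F ℤ.≤ + 0 → N + F ≤ E
euler≤0⇒N+F≤E N E F χ≤0 = ℤP.drop‿+≤+ (subst₂ ℤ._≤_ χ+E≡N+F (ℤP.+-identityˡ (+ E)) (ℤP.+-monoˡ-≤ (+ E) χ≤0))
  where
  rearrange : ∀ n e f → ((n ℤ.- e) ℤ.+ f) ℤ.+ e ≡ n ℤ.+ f
  rearrange = ℤ-solve-∀
  χ+E≡N+F : eulerOf N E F ℤ.+ + E ≡ + (N + F)
  χ+E≡N+F = trans (rearrange (+ N) (+ E) (+ F)) (sym (ℤP.pos-+ N F))

faces-of-empty : ∀ {G} (e : Embedding G) → edges G ≡ 0 → faces e ≡ 1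
faces-of-empty {G} e E≡0 with edges G
... | zero = refl

euler≤0⇒edge : ∀ {G} (e : Embedding G) → eulerChar e ℤ.≤ + 0 → 1 ≤ edges G
euler≤0⇒edge {G} e χ≤0 with 1 ≤? edges G
... | yes E≥1 = E≥1
... | no  E≱1 = ⊥-elim (<⇒≱ (s≤s z≤n) (≤-trans (m≤n+m 1 (n G)) (subst₂ _≤_ (cong (λ f → n G + f) (faces-of-empty e E≡0)) E≡0 N+F≤E)))
  where
  E≡0 : edges G ≡ 0
  E≡0 = n≤0⇒n≡0 (≮⇒≥ E≱1)
  N+F≤E = euler≤0⇒N+F≤E (n G) (edges G) (faces e) χ≤0

module _ (G : Graph) (conn : Connected G) (e : Embedding G) (χ≤0 : eulerChar e ℤ.≤ + 0) where

  private
    N = n G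
    E = edges G
    F = faces e
    E≥1 = euler≤0⇒edge e χ≤0
    N+F≤E = euler≤0⇒N+F≤E N E F χ≤0

  Δ+h≤b′⇒LeC : ∀ h → + maxDeg G ℤ.+ h ℤ.≤ + b′ G → LeC N (eulerChar e) h
  Δ+h≤b′⇒LeC -[1+ j ] _ = LeC-negative N E F j (fin⇒0< (proj₁ (edge-from-edges G E≥1))) N+F≤E
  Δ+h≤b′⇒LeC (+ h) Δ+h≤b′ with h ≤? 2
  ... | yes h≤2 = FaceBound⇒LeC N E F h (faceBound-small N E F h (≤-trans h≤2 (n≤1+n 2)) N+F≤E)
  ... | no  h≰2 = FaceBound⇒LeC N E F h (faceBound-large G conn e E≥1 h (≰⇒> h≰2)
                    (ℤP.drop‿+≤+ (subst (ℤ._≤ + b′ G) (sym (ℤP.pos-+ (maxDeg G) h)) Δ+h≤b′)))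

b′≤Δ+⌊c⌋ : ∀ G → Connected G → ∀ χ → IsSurfaceEulerChar G χ → χ ℤ.≤ + 0 →
           ∀ m → IsFloorC (n G) χ m → + b′ G ℤ.≤ + maxDeg G ℤ.+ m
b′≤Δ+⌊c⌋ G conn χ ((e , refl) , _) χ≤0 m (_ , ¬m+1≤c) with + b′ G ℤP.≤? + maxDeg G ℤ.+ m
... | yes b′≤Δ+m = b′≤Δ+m
... | no  b′≰Δ+m = ⊥-elim (¬m+1≤c (Δ+h≤b′⇒LeC G conn e χ≤0 (m ℤ.+ + 1) Δ+[m+1]≤b′))
  where
  reassoc : ∀ a b → + 1 ℤ.+ (a ℤ.+ b) ≡ a ℤ.+ (b ℤ.+ + 1)
  reassoc = ℤ-solve-∀
  Δ+[m+1]≤b′ : + maxDeg G ℤ.+ (m ℤ.+ + 1) ℤ.≤ + b′ G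
  Δ+[m+1]≤b′ = subst (ℤ._≤ + b′ G) (reassoc (+ maxDeg G) m) (ℤP.i<j⇒suc[i]≤j (ℤP.≰⇒> b′≰Δ+m))

mainTheorem5 : (G : Graph) → Connected G → (χ : ℤ) → IsSurfaceEulerChar G χ → χ ℤ.≤ + 0 →
    (∀ b → IsBondageNumber G b → b ≤ b′ G)
    × (∀ m → IsFloorC (n G) χ m → + b′ G ℤ.≤ + maxDeg G ℤ.+ m)
mainTheorem5 G conn χ surface@((e , χₑ≡χ) , _) χ≤0 =
  bondage≤b′ G conn (euler≤0⇒edge e (subst (ℤ._≤ + 0) (sym χₑ≡χ) χ≤0)) , b′≤Δ+⌊c⌋ G conn χ surface χ≤0
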